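{- Let $q$ be a power of a prime $p$, let $\ell\neq p$ be a prime and $\mathbf{F}$ a finite field of characteristic $\ell$. Let $\overline G_q=\hat{\mathbf Z}'\rtimes\hat{\mathbf Z}$, topologically generated by $t$ (a generator of $\hat{\mathbf Z}'$) and $s$ (a generator of $\hat{\mathbf Z}$) with $sts^{ -1}=t^q$, and let $\mathbf{F}(1)$ be $\mathbf{F}$ with $t$ acting trivially and $s$ acting by multiplication by $q$. Then the map sending a normalized continuous $2$-cocycle $[\cdot,\cdot]:\overline G_q\times\overline G_q\to\mathbf{F}(1)$ to $$\sum_{i=1}^{q^{\ell-1}-1}[t^i,t]+[t^{q^{\ell-1}},s^{\ell-1}]-[s^{\ell-1},t]\in\mathbf{F}$$ induces an isomorphism $H^2(\overline G_q,\mathbf{F}(1))\xrightarrow{\ \cong\ }\mathbf{F}$.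
   Context: $\hat{\mathbf Z}$ is the profinite completion of $\mathbf Z$ and $\hat{\mathbf Z}'$ its prime-to-$p$ completion; cohomology is continuous group cohomology. A normalized $2$-cocycle is a map $[\cdot,\cdot]$ with $[1,g]=[g,1]=0$ and $f[g,h]-[fg,h]+[f,gh]-[f,g]=0$ for all $f,g,h$. -}

module Defs where

-- Part 1: elementary number theory needed to *define* the group
-- (the multiplication of Zhat' ⋊ Zhat is well defined because
--  q^(N!) ≡ 1 mod N whenever N is prime to q).

open import Data.Nat
open import Data.Nat.Properties
open import Data.Nat.DivMod
open import Data.Nat.Divisibility
open import Data.Nat.Coprimality using (Coprime; coprime-Bézout; coprime-divisor)
import Data.Nat.Coprimality as Cop
open import Data.Nat.GCD using (module Bézout)
open import Data.Fin using (Fin; toℕ; fromℕ<)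
open import Data.Fin.Properties using (pigeonhole; toℕ-fromℕ<; toℕ<n)
open import Data.Product using (Σ; ∃; Σ-syntax; _,_; _×_; proj₁; proj₂)
open import Data.Unit using (⊤; tt)
open import Level using (Level)
open import Algebra.Bundles using (CommutativeRing)
open import Relation.Nullary using (¬_)
open import Relation.Binary.PropositionalEquality
*-mod : ∀ a b c d m → a % suc m ≡ b % suc m → c % suc m ≡ d % suc m →
        (a * c) % suc m ≡ (b * d) % suc m
*-mod a b c d m e f = trans (%-distribˡ-* a c (suc m))
  (trans (cong₂ (λ x y → (x * y) % suc m) e f) (sym (%-distribˡ-* b d (suc m))))

^-mod : ∀ {a b} m k → a % suc m ≡ b % suc m → (a ^ k) % suc m ≡ (b ^ k) % suc m
^-mod m zero e = refl
^-mod {a} {b} m (suc k) e = *-mod a b (a ^ k) (b ^ k) m e (^-mod m k e)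

one-pow : ∀ {a} m k → a % suc m ≡ 1 % suc m → (a ^ k) % suc m ≡ 1 % suc m
one-pow {a} m k e = trans (^-mod m k e) (cong (_% suc m) (^-zeroˡ k))

^-distribʳ-* : ∀ a b k → (a * b) ^ k ≡ a ^ k * b ^ k
^-distribʳ-* a b zero = refl
^-distribʳ-* a b (suc k) rewrite ^-distribʳ-* a b k = solve
  where
  solve : a * b * (a ^ k * b ^ k) ≡ a * a ^ k * (b * b ^ k)
  solve = trans (*-assoc a b _) (trans (cong (a *_) (trans (sym (*-assoc b (a ^ k) _))
            (trans (cong (_* b ^ k) (*-comm b (a ^ k))) (*-assoc (a ^ k) b _))))
            (sym (*-assoc a (a ^ k) _)))

inverse : ∀ q m → Coprime q (suc m) → ∃ λ u → (q * u) % suc m ≡ 1 % suc m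
inverse q m c with coprime-Bézout c
... | Bézout.+- x y eq = x , trans (cong (_% suc m) (trans (*-comm q x) (sym eq)))
                                    ([m+kn]%n≡m%n 1 y (suc m))
... | Bézout.-+ x y eq = x * m , goal
  where
  A = q * (x * m)
  e1 : A + m ≡ y * m * suc m
  e1 = begin
    q * (x * m) + m   ≡⟨ cong (_+ m) (sym (*-assoc q x m)) ⟩
    q * x * m + m     ≡⟨ cong₂ (λ z w → z * m + w) (*-comm q x) (sym (*-identityˡ m)) ⟩
    x * q * m + 1 * m ≡⟨ sym (*-distribʳ-+ m (x * q) 1) ⟩
    (x * q + 1) * m   ≡⟨ cong (_* m) (trans (+-comm (x * q) 1) eq) ⟩
    y * suc m * m     ≡⟨ *-assoc y (suc m) m ⟩
    y * (suc m * m)   ≡⟨ cong (y *_) (*-comm (suc m) m) ⟩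
    y * (m * suc m)   ≡⟨ sym (*-assoc y m (suc m)) ⟩
    y * m * suc m     ∎
    where open ≡-Reasoning
  e2 : A + 1 * suc m ≡ 1 + y * m * suc m
  e2 = trans (cong (A +_) (+-identityʳ (suc m)))
        (trans (+-suc A m) (cong suc e1))
  goal : A % suc m ≡ 1 % suc m
  goal = trans (sym ([m+kn]%n≡m%n A 1 (suc m)))
          (trans (cong (_% suc m) e2) ([m+kn]%n≡m%n 1 (y * m) (suc m)))

pow-split : ∀ q K x .{{_ : NonZero K}} → q ^ x ≡ q ^ (x % K) * (q ^ K) ^ (x / K)
pow-split q K x = begin
  q ^ x                         ≡⟨ cong (q ^_) (m≡m%n+[m/n]*n x K) ⟩
  q ^ (x % K + x / K * K)       ≡⟨ ^-distribˡ-+-* q (x % K) _ ⟩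
  q ^ (x % K) * q ^ (x / K * K) ≡⟨ cong (λ z → q ^ (x % K) * q ^ z) (*-comm (x / K) K) ⟩
  q ^ (x % K) * q ^ (K * (x / K)) ≡⟨ cong (q ^ (x % K) *_) (sym (^-*-assoc q K (x / K))) ⟩
  q ^ (x % K) * (q ^ K) ^ (x / K) ∎
  where open ≡-Reasoning

pow-red : ∀ q m K .{{_ : NonZero K}} → (q ^ K) % suc m ≡ 1 % suc m →
          ∀ x → (q ^ x) % suc m ≡ (q ^ (x % K)) % suc m
pow-red q m K e x = trans (cong (_% suc m) (pow-split q K x))
  (trans (*-mod (q ^ (x % K)) (q ^ (x % K)) ((q ^ K) ^ (x / K)) 1 m refl (one-pow m (x / K) e))
         (cong (_% suc m) (*-identityʳ (q ^ (x % K)))))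

n∣n! : ∀ n → suc n ∣ suc n !
n∣n! n = m∣m*n (n !)

euler! : ∀ q m → Coprime q (suc m) → (q ^ (suc m !)) % suc m ≡ 1 % suc m
euler! q m c with inverse q m c
... | u , qu with pigeonhole (n<1+n (suc m)) f
  where
  f : Fin (suc (suc m)) → Fin (suc m)
  f i = fromℕ< (m%n<n (q ^ toℕ i) (suc m))
... | i , j , i<j , fij = final
  where
  M = suc m
  In = toℕ i
  Jn = toℕ j
  d = Jn ∸ In
  eqIJ : (q ^ In) % M ≡ (q ^ Jn) % M
  eqIJ = trans (sym (toℕ-fromℕ< (m%n<n (q ^ In) M)))
          (trans (cong toℕ fij) (toℕ-fromℕ< (m%n<n (q ^ Jn) M)))
  Jsplit : q ^ Jn ≡ q ^ In * q ^ d
  Jsplit = trans (cong (q ^_) (sym (m+[n∸m]≡n (<⇒≤ i<j)))) (^-distribˡ-+-* q In d)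
  w : (u ^ In * q ^ In) % M ≡ 1 % M
  w = trans (cong (_% M) (trans (sym (^-distribʳ-* u q In)) (cong (_^ In) (*-comm u q))))
            (one-pow m In qu)
  qd : (q ^ d) % M ≡ 1 % M
  qd = begin
    (q ^ d) % M                 ≡⟨ cong (_% M) (sym (*-identityˡ (q ^ d))) ⟩
    (1 * q ^ d) % M             ≡⟨ *-mod 1 (u ^ In * q ^ In) (q ^ d) (q ^ d) m (sym w) refl ⟩
    (u ^ In * q ^ In * q ^ d) % M ≡⟨ cong (_% M) (trans (*-assoc (u ^ In) _ _) (cong (u ^ In *_) (sym Jsplit))) ⟩
    (u ^ In * q ^ Jn) % M         ≡⟨ *-mod (u ^ In) (u ^ In) (q ^ Jn) (q ^ In) m refl (sym eqIJ) ⟩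
    (u ^ In * q ^ In) % M         ≡⟨ w ⟩
    1 % M                       ∎
    where open ≡-Reasoning
  d≤M : d ≤ M
  d≤M = ≤-trans (m∸n≤m Jn In) (≤-pred (toℕ<n j))
  d∣ : d ∣ M !
  d∣ with d | m<n⇒0<n∸m i<j | d≤M
  ... | suc d' | _ | le = ∣-trans (n∣n! d') (m≤n⇒m!∣n! le)
  final : (q ^ (M !)) % M ≡ 1 % M
  final with d∣
  ... | divides k eq = trans (cong (_% M) (trans (cong (q ^_) (trans eq (*-comm k d)))
                          (sym (^-*-assoc q d k)))) (one-pow m k qd)

coprime-* : ∀ {a b c} → Coprime a b → Coprime a c → Coprime a (b * c)
coprime-* {a} {b} {c} ab ac {d} (d∣a , d∣bc) = ac (d∣a , coprime-divisor db d∣bc)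
  where
  db : Coprime d b
  db (e∣d , e∣b) = ab (∣-trans e∣d d∣a , e∣b)

coprime-^ : ∀ {a b} k → Coprime a b → Coprime a (b ^ k)
coprime-^ zero ab (_ , e∣1) = ∣1⇒≡1 e∣1
coprime-^ (suc k) ab = coprime-* ab (coprime-^ k ab)

-- Lim P  =  lim_N Z/N over the moduli N = suc n with P n, ordered by
-- divisibility.  An element is a compatible family of residues: the
-- component at index n represents a class mod (suc n) (compatibility
-- with m = n forces it to be < suc n).

record Lim (P : ℕ → Set) : Set where
  field
    comp   : (n : ℕ) → .(P n) → ℕ
    compat : ∀ m n .(hm : P m) .(hn : P n) → suc m ∣ suc n →
             comp n hn % suc m ≡ comp m hm
open Lim public

Zhat : Set
Zhat = Lim (λ _ → ⊤)

PrimeTo : ℕ → ℕ → Set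
PrimeTo p n = Coprime (suc n) p

Zhat′ : ℕ → Set
Zhat′ p = Lim (PrimeTo p)

ι : ∀ {P} → ℕ → Lim P
comp (ι k) n _ = k % suc n
compat (ι k) m n _ _ d = m∣n⇒o%n%m≡o%m (suc m) (suc n) k d

_⊞_ : ∀ {P} → Lim P → Lim P → Lim P
comp (x ⊞ y) n h = (comp x n h + comp y n h) % suc n
compat (x ⊞ y) m n hm hn d = begin
    ((comp x n hn + comp y n hn) % suc n) % suc m
      ≡⟨ m∣n⇒o%n%m≡o%m (suc m) (suc n) (comp x n hn + comp y n hn) d ⟩
    (comp x n hn + comp y n hn) % suc m
      ≡⟨ %-distribˡ-+ (comp x n hn) (comp y n hn) (suc m) ⟩
    (comp x n hn % suc m + comp y n hn % suc m) % suc m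
      ≡⟨ cong₂ (λ u v → (u + v) % suc m) (compat x m n hm hn d) (compat y m n hm hn d) ⟩
    (comp x m hm + comp y m hm) % suc m ∎
  where open ≡-Reasoning

-- Part 3: the group  Gbar_q = Zhat' ⋊ Zhat  (q = p ^ k),
-- t = (1, 0) generates Zhat', s = (0, 1) generates Zhat, and
-- s t s⁻¹ = t^q, i.e. (a , b) · (a′ , b′) = (a + q^b a′ , b + b′).

-- index of the modulus (suc n)! ; the action of b ∈ Zhat on Z/(suc n)
-- (suc n prime to q) is multiplication by q^(b mod (suc n)!), which is
-- well defined since the order of q mod (suc n) divides (suc n)!.
fac : ℕ → ℕ
fac n = pred (suc n !)

sfac : ∀ n → suc (fac n) ≡ suc n !
sfac n = suc-pred (suc n !) {{suc n !≢0}}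

module SemiDirect (p k : ℕ) where

  q : ℕ
  q = p ^ k

  act : Zhat → Zhat′ p → Zhat′ p
  comp (act b a) n h = (q ^ comp b (fac n) tt * comp a n h) % suc n
  compat (act b a) m n hm hn d = begin
      ((q ^ BN * comp a n hn) % suc n) % suc m
        ≡⟨ m∣n⇒o%n%m≡o%m (suc m) (suc n) (q ^ BN * comp a n hn) d ⟩
      (q ^ BN * comp a n hn) % suc m
        ≡⟨ *-mod (q ^ BN) (q ^ BM) (comp a n hn) (comp a m hm) m e1 e2 ⟩
      (q ^ BM * comp a m hm) % suc m ∎
    where
    open ≡-Reasoning
    BN = comp b (fac n) tt
    BM = comp b (fac m) tt
    e2 : comp a n hn % suc m ≡ comp a m hm % suc m
    e2 = trans (compat a m n hm hn d) (sym (compat a m m hm hm ∣-refl))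
    cq : Coprime q (suc m)
    cq = Cop.sym (coprime-^ k (Cop.recompute hm))
    eul : (q ^ suc (fac m)) % suc m ≡ 1 % suc m
    eul = subst (λ z → (q ^ z) % suc m ≡ 1 % suc m) (sym (sfac m)) (euler! q m cq)
    dv : suc (fac m) ∣ suc (fac n)
    dv = subst₂ _∣_ (sym (sfac m)) (sym (sfac n)) (m≤n⇒m!∣n! (∣⇒≤ d))
    e1 : (q ^ BN) % suc m ≡ (q ^ BM) % suc m
    e1 = trans (pow-red q m (suc (fac m)) eul BN)
               (cong (λ z → (q ^ z) % suc m) (compat b (fac m) (fac n) tt tt dv))

  record Gbar : Set where
    constructor _,_
    field
      za : Zhat′ p
      zb : Zhat
  open Gbar public

  infixl 7 _·_
  _·_ : Gbar → Gbar → Gbar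
  (a , b) · (a′ , b′) = (a ⊞ act b a′) , (b ⊞ b′)

  e : Gbar
  e = ι 0 , ι 0

  t : Gbar
  t = ι 1 , ι 0

  s : Gbar
  s = ι 0 , ι 1

  _^ᴳ_ : Gbar → ℕ → Gbar
  g ^ᴳ zero  = e
  g ^ᴳ suc n = g · (g ^ᴳ n)

  -- g and g′ lie in the same coset of the open normal subgroup
  -- (suc n) Zhat' ⋊ (suc m) Zhat  (these form a basis of neighbourhoods
  -- of the identity of the profinite group Gbar)
  Close : (n : ℕ) → PrimeTo p n → ℕ → Gbar → Gbar → Set
  Close n hn m g g′ = (comp (za g) n hn ≡ comp (za g′) n hn)
                    × (comp (zb g) m tt ≡ comp (zb g′) m tt)

module _ {c r : Level} (F : CommutativeRing c r) where
  open CommutativeRing F using (Carrier; _≈_; 0#; 1#)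
    renaming (_+_ to _+ᶠ_; _*_ to _*ᶠ_; -_ to -ᶠ_)

  natF : ℕ → Carrier
  natF zero    = 0#
  natF (suc n) = 1# +ᶠ natF n

  powF : Carrier → ℕ → Carrier
  powF x zero    = 1#
  powF x (suc n) = x *ᶠ powF x n

  record IsField : Set (c Level.⊔ r) where
    field
      0≉1 : ¬ (0# ≈ 1#)
      inv : ∀ x → ¬ (x ≈ 0#) → Σ[ y ∈ Carrier ] (x *ᶠ y ≈ 1#)

  IsFinite : Set (c Level.⊔ r)
  IsFinite = Σ[ n ∈ ℕ ] Σ[ enum ∈ (Fin n → Carrier) ] (∀ x → Σ[ i ∈ Fin n ] (enum i ≈ x))

  HasCharacteristic : ℕ → Set r
  HasCharacteristic ℓ = (0 < ℓ) × (natF ℓ ≈ 0#) × (∀ n → natF (suc n) ≈ 0# → ℓ ≤ suc n)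

module Coh (p k ℓ : ℕ) {c r : Level} (F : CommutativeRing c r) where
  open SemiDirect p k public
  open CommutativeRing F public using (Carrier; _≈_; 0#; 1#)
    renaming (_+_ to _+ᶠ_; _*_ to _*ᶠ_; -_ to -ᶠ_)

  infixl 6 _−_
  _−_ : Carrier → Carrier → Carrier
  x − y = x +ᶠ (-ᶠ y)

  -- the action of Gbar on F(1): (a , b) acts by q^b.  Since q^(ℓ-1) = 1
  -- in F (characteristic ℓ, ℓ ∤ q), q^b := q^(b mod (ℓ-1)); the index of
  -- the modulus ℓ-1 is ℓ ∸ 2.
  infixr 8 _▹_
  _▹_ : Gbar → Carrier → Carrier
  g ▹ x = powF F (natF F q) (comp (zb g) (ℓ ∸ 2) tt) *ᶠ x

  Cochain₁ : Set c
  Cochain₁ = Gbar → Carrier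

  Cochain₂ : Set c
  Cochain₂ = Gbar → Gbar → Carrier

  -- continuity (F discrete): locally constant, i.e. factors through some
  -- finite quotient Gbar / ((suc n) Zhat' ⋊ (suc m) Zhat)
  Continuous₁ : Cochain₁ → Set r
  Continuous₁ φ = Σ[ n ∈ ℕ ] Σ[ hn ∈ PrimeTo p n ] Σ[ m ∈ ℕ ]
    (∀ g g′ → Close n hn m g g′ → φ g ≈ φ g′)

  Continuous₂ : Cochain₂ → Set r
  Continuous₂ γ = Σ[ n ∈ ℕ ] Σ[ hn ∈ PrimeTo p n ] Σ[ m ∈ ℕ ]
    (∀ g g′ h h′ → Close n hn m g g′ → Close n hn m h h′ → γ g h ≈ γ g′ h′)

  record IsNormalizedCocycle (γ : Cochain₂) : Set r where
    field
      continuous : Continuous₂ γ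
      normˡ      : ∀ g → γ e g ≈ 0#
      normʳ      : ∀ g → γ g e ≈ 0#
      cocycle    : ∀ f g h → f ▹ γ g h − γ (f · g) h +ᶠ γ f (g · h) − γ f g ≈ 0#

  IsCoboundary : Cochain₂ → Set (c Level.⊔ r)
  IsCoboundary γ = Σ[ φ ∈ Cochain₁ ] Continuous₁ φ ×
    (∀ g h → γ g h ≈ g ▹ φ h − φ (g · h) +ᶠ φ g)

  _⊕_ : Cochain₂ → Cochain₂ → Cochain₂
  (γ ⊕ δ) g h = γ g h +ᶠ δ g h

  _⊙_ : Carrier → Cochain₂ → Cochain₂
  (x ⊙ γ) g h = x *ᶠ γ g h

  Σ₁ : ℕ → (ℕ → Carrier) → Carrier
  Σ₁ zero    f = 0#
  Σ₁ (suc n) f = Σ₁ n f +ᶠ f (suc n)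

  Φ : Cochain₂ → Carrier
  Φ γ = Σ₁ (q ^ (ℓ ∸ 1) ∸ 1) (λ i → γ (t ^ᴳ i) t)
        +ᶠ γ (t ^ᴳ (q ^ (ℓ ∸ 1))) (s ^ᴳ (ℓ ∸ 1))
        − γ (s ^ᴳ (ℓ ∸ 1)) t

{-# OPTIONS --safe #-}
-- A continuous cochain on Ḡ_q is determined by its values on the dense submonoid of elements
-- tᵃsᵇ, a copy of ℕ ⋊ ℕ on which it is an ordinary cocycle. Subtracting the coboundary of an
-- explicit φ₀ built from prefix sums, a cocycle γ can be made to vanish on the pairs (tᵃ, sᵇ),
-- (tᵃ, t) and (sᵇ, s); the cocycle identity then forces γ (tᵃsᵇ, tˣsʸ) = x·D(b) with
-- D(b+1) = q·D(b) + qᵇ·D(1), so that q·D(b) = b·qᵇ·D(1) and, by Fermat (q^(ℓ-1) = 1 and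
-- ℓ - 1 = -1 in F), Φ γ = -D(ℓ-1) = D(1)/q. Hence Φ γ = 0 makes γ a coboundary; the cochain φ₀
-- is locally constant because prefix sums of an N-periodic function are ℓN-periodic when ℓ = 0.
-- Conversely Φ kills coboundaries by telescoping, and the cup product of the homomorphism
-- tᵃsᵇ ↦ x·b with the crossed homomorphism tᵃsᵇ ↦ a (both read mod ℓ) is a cocycle with Φ = x.
module Submission where

open import Defs
open import Data.Nat using (ℕ; _≤_)
open import Data.Nat.Primality using (Prime)
open import Data.Product using (Σ-syntax; _×_)
open import Relation.Nullary using (¬_)
open import Relation.Binary.PropositionalEquality using (_≡_)
open import Algebra.Bundles using (CommutativeRing)

open import Level using (Level)
open import Data.Nat as ℕ using (zero; suc; _+_; _*_; _^_; _∸_; _<_; _!; s≤s; z≤n)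
import Data.Nat.Properties as ℕ
open import Data.Nat.DivMod
  using (_%_; _/_; m≡m%n+[m/n]*n; m/n*n≡m; [m+n]%n≡m%n; m∣n⇒o%n%m≡o%m; %-distribˡ-+; m%n%n≡m%n; m<n⇒m%n≡m; n%n≡0)
open import Data.Nat.Divisibility using (_∣_; ∣1⇒≡1; ∣-refl; divides; ∣⇒≤; ∣-trans; n∣m*n; m∣m*n)
open import Data.Nat.Combinatorics using (_C_; nCk≡n!/k![n-k]!; k![n∸k]!∣n!; nCn≡1)
open import Data.Nat.Coprimality as Coprime using (Coprime)
open import Data.Nat.Primality using (euclidsLemma; prime⇒nonZero; prime⇒nonTrivial)
open import Data.Nat.Base using (nonTrivial⇒≢1; nonTrivial⇒n>1)
open import Data.Integer as ℤ using (ℤ; -[1+_])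
import Data.Integer.Properties as ℤ
open import Data.Sign as Sign using (Sign)
open import Data.Fin as Fin using (toℕ; fromℕ; inject₁)
import Data.Fin.Properties as Fin
open import Data.Maybe using (Maybe; just; nothing)
open import Data.Product using (_,_; proj₁; proj₂)
open import Data.Unit using (tt)
open import Data.Sum using (inj₁; inj₂)
open import Data.Empty using (⊥-elim)
open import Relation.Nullary using (yes; no; contradiction)
open import Relation.Binary.Definitions using (tri<; tri≈; tri>)
open import Relation.Binary.PropositionalEquality as ≡ using (cong; cong₂)
import Relation.Binary.Reasoning.Setoid as SetoidReasoning

prime∤! : ∀ {ℓ m} → Prime ℓ → m < ℓ → ¬ (ℓ ∣ m !)
prime∤! {m = zero}  pℓ m<ℓ ℓ∣1 = nonTrivial⇒≢1 {{prime⇒nonTrivial pℓ}} (∣1⇒≡1 ℓ∣1)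
prime∤! {m = suc m} pℓ m<ℓ ℓ∣m! with euclidsLemma (suc m) (m !) pℓ ℓ∣m!
... | inj₁ ℓ∣1+m = ℕ.<⇒≱ m<ℓ (∣⇒≤ ℓ∣1+m)
... | inj₂ ℓ∣m!  = prime∤! pℓ (ℕ.<-trans (ℕ.n<1+n m) m<ℓ) ℓ∣m!

C*k!*[n∸k]!≡n! : ∀ {n k} → k ≤ n → (n C k) * (k ! * (n ∸ k) !) ≡ n !
C*k!*[n∸k]!≡n! {n} {k} k≤n = ≡.trans (cong (_* (k ! * (n ∸ k) !)) (nCk≡n!/k![n-k]! k≤n))
                                    (m/n*n≡m (k![n∸k]!∣n! k≤n))
  where instance _ = k ℕ.!* (n ∸ k) !≢0

prime∣choose : ∀ {ℓ k} → Prime ℓ → 0 < k → k < ℓ → ℓ ∣ ℓ C k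
prime∣choose {suc m} {k} pℓ 0<k k<ℓ
  with euclidsLemma (suc m C k) (k ! * (suc m ∸ k) !) pℓ
         (≡.subst (suc m ∣_) (≡.sym (C*k!*[n∸k]!≡n! (ℕ.<⇒≤ k<ℓ))) (n∣n! m))
... | inj₁ ℓ∣C = ℓ∣C
... | inj₂ ℓ∣k!*[ℓ∸k]! with euclidsLemma (k !) ((suc m ∸ k) !) pℓ ℓ∣k!*[ℓ∸k]!
...   | inj₁ ℓ∣k!      = ⊥-elim (prime∤! pℓ k<ℓ ℓ∣k!)
...   | inj₂ ℓ∣[ℓ∸k]! = ⊥-elim (prime∤! pℓ (ℕ.∸-monoʳ-< 0<k (ℕ.<⇒≤ k<ℓ)) ℓ∣[ℓ∸k]!)

prime⇒2≤ : ∀ {n} → Prime n → 2 ≤ n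
prime⇒2≤ {n} n-prime = nonTrivial⇒n>1 n {{prime⇒nonTrivial n-prime}}

coprime-primes : ∀ {a b} → Prime a → Prime b → ¬ (a ≡ b) → Coprime a b
coprime-primes {a} {b} a-prime b-prime a≢b with ℕ.<-cmp a b
... | tri< a<b _ _ = Coprime.sym (Coprime.prime⇒coprime b-prime {{prime⇒nonZero a-prime}} a<b)
... | tri≈ _ a≡b _ = ⊥-elim (a≢b a≡b)
... | tri> _ _ b<a = Coprime.prime⇒coprime a-prime {{prime⇒nonZero b-prime}} b<a

comp-coarsen : ∀ {P : ℕ → Set} (x y : Lim P) {j m} .(hj : P j) .(hm : P m) → suc j ∣ suc m →
               comp x m hm ≡ comp y m hm → comp x j hj ≡ comp y j hj
comp-coarsen x y {j} {m} hj hm j∣m xₘ≡yₘ =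
  ≡.trans (≡.sym (compat x j m hj hm j∣m)) (≡.trans (cong (_% suc j) xₘ≡yₘ) (compat y j m hj hm j∣m))

+-mod : ∀ a b c d n → a % suc n ≡ b % suc n → c % suc n ≡ d % suc n → (a + c) % suc n ≡ (b + d) % suc n
+-mod a b c d n a≡b c≡d = ≡.trans (%-distribˡ-+ a c (suc n))
  (≡.trans (cong₂ (λ x y → (x + y) % suc n) a≡b c≡d) (≡.sym (%-distribˡ-+ b d (suc n))))

-- Tactic.RingSolver takes its coefficients from F itself and so cannot cancel x - x; this is
-- Algebra.Solver.Ring with integer coefficients, through the image of ℤ in F.
module CommutativeRingSolver {c r : Level} (F : CommutativeRing c r) where
  open CommutativeRing F renaming (_+_ to _+ᶠ_; _*_ to _*ᶠ_; -_ to -ᶠ_; _-_ to _−_)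
  open import Algebra.Properties.Ring ring
    using (-0#≈0#; -‿involutive; -1*x≈-x; -‿+-comm; ⁻¹-anti-homo‿-; xyx⁻¹≈y)
  open import Algebra.Properties.Semiring.Mult.TCOptimised semiring
    using (×-homo-+; ×1-homo-*) renaming (_×_ to _×′_)
  open import Algebra.Properties.CommutativeSemigroup *-commutativeSemigroup using (interchange)
  open import Algebra.Solver.Ring.AlmostCommutativeRing
    using (_-Raw-AlmostCommutative⟶_; fromCommutativeRing)
  open SetoidReasoning setoid

  -- The optimised multiplication (1 ×′ x = x) makes con (ℤ.+ 1) evaluate to 1# itself.
  ⟦_⟧ : ℤ → Carrier
  ⟦ ℤ.+ n ⟧    = n ×′ 1#
  ⟦ -[1+ n ] ⟧ = -ᶠ (suc n ×′ 1#)

  ⟦⟧-homo-neg : ∀ i → ⟦ ℤ.- i ⟧ ≈ -ᶠ ⟦ i ⟧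
  ⟦⟧-homo-neg (ℤ.+ zero)  = sym -0#≈0#
  ⟦⟧-homo-neg (ℤ.+ suc n) = refl
  ⟦⟧-homo-neg -[1+ n ]    = sym (-‿involutive _)

  ×1-homo-∸ : ∀ {m n} → n ≤ m → (m ∸ n) ×′ 1# ≈ m ×′ 1# − n ×′ 1#
  ×1-homo-∸ {m} {n} n≤m = begin
    (m ∸ n) ×′ 1#                        ≈⟨ xyx⁻¹≈y (n ×′ 1#) _ ⟨
    n ×′ 1# +ᶠ (m ∸ n) ×′ 1# − n ×′ 1#   ≈⟨ +-congʳ (×-homo-+ 1# n (m ∸ n)) ⟨
    (n + (m ∸ n)) ×′ 1# − n ×′ 1#        ≡⟨ cong (λ k → k ×′ 1# − n ×′ 1#) (ℕ.m+[n∸m]≡n n≤m) ⟩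
    m ×′ 1# − n ×′ 1#                    ∎

  ⟦⟧-homo-⊖ : ∀ m n → ⟦ m ℤ.⊖ n ⟧ ≈ m ×′ 1# − n ×′ 1#
  ⟦⟧-homo-⊖ m n with ℕ.≤-total n m
  ... | inj₁ n≤m = trans (reflexive (cong ⟦_⟧ (ℤ.⊖-≥ n≤m))) (×1-homo-∸ n≤m)
  ... | inj₂ m≤n = begin
    ⟦ m ℤ.⊖ n ⟧               ≡⟨ cong ⟦_⟧ (ℤ.⊖-≤ m≤n) ⟩
    ⟦ ℤ.- ℤ.+ (n ∸ m) ⟧       ≈⟨ ⟦⟧-homo-neg (ℤ.+ (n ∸ m)) ⟩
    -ᶠ ((n ∸ m) ×′ 1#)        ≈⟨ -‿cong (×1-homo-∸ m≤n) ⟩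
    -ᶠ (n ×′ 1# − m ×′ 1#)    ≈⟨ ⁻¹-anti-homo‿- _ _ ⟩
    m ×′ 1# − n ×′ 1#         ∎

  ⟦⟧-homo-+ : ∀ i j → ⟦ i ℤ.+ j ⟧ ≈ ⟦ i ⟧ +ᶠ ⟦ j ⟧
  ⟦⟧-homo-+ -[1+ m ] -[1+ n ] = begin
    -ᶠ (suc (suc (m + n)) ×′ 1#)           ≡⟨ cong (λ k → -ᶠ (k ×′ 1#)) (≡.sym (ℕ.+-suc (suc m) n)) ⟩
    -ᶠ ((suc m + suc n) ×′ 1#)             ≈⟨ -‿cong (×-homo-+ 1# (suc m) (suc n)) ⟩
    -ᶠ (suc m ×′ 1# +ᶠ suc n ×′ 1#)        ≈⟨ -‿+-comm _ _ ⟨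
    -ᶠ (suc m ×′ 1#) +ᶠ -ᶠ (suc n ×′ 1#)   ∎
  ⟦⟧-homo-+ -[1+ m ] (ℤ.+ n)   = trans (⟦⟧-homo-⊖ n (suc m)) (+-comm _ _)
  ⟦⟧-homo-+ (ℤ.+ m)  -[1+ n ]  = ⟦⟧-homo-⊖ m (suc n)
  ⟦⟧-homo-+ (ℤ.+ m)  (ℤ.+ n)   = ×-homo-+ 1# m n

  σ : Sign → Carrier
  σ Sign.+ = 1#
  σ Sign.- = -ᶠ 1#

  σ-homo-* : ∀ s s′ → σ (s Sign.* s′) ≈ σ s *ᶠ σ s′
  σ-homo-* Sign.+ s′     = sym (*-identityˡ _)
  σ-homo-* Sign.- Sign.+ = sym (*-identityʳ _)
  σ-homo-* Sign.- Sign.- = sym (trans (-1*x≈-x _) (-‿involutive _))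

  ⟦◃⟧ : ∀ s n → ⟦ s ℤ.◃ n ⟧ ≈ σ s *ᶠ (n ×′ 1#)
  ⟦◃⟧ s      zero    = sym (zeroʳ _)
  ⟦◃⟧ Sign.+ (suc n) = sym (*-identityˡ _)
  ⟦◃⟧ Sign.- (suc n) = sym (-1*x≈-x _)

  ⟦⟧-sign : ∀ i → ⟦ i ⟧ ≈ σ (ℤ.sign i) *ᶠ (ℤ.∣ i ∣ ×′ 1#)
  ⟦⟧-sign i = trans (reflexive (cong ⟦_⟧ (≡.sym (ℤ.◃-inverse i)))) (⟦◃⟧ (ℤ.sign i) ℤ.∣ i ∣)

  ⟦⟧-homo-* : ∀ i j → ⟦ i ℤ.* j ⟧ ≈ ⟦ i ⟧ *ᶠ ⟦ j ⟧
  ⟦⟧-homo-* i j = begin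
    ⟦ i ℤ.* j ⟧
      ≈⟨ ⟦◃⟧ (ℤ.sign i Sign.* ℤ.sign j) (ℤ.∣ i ∣ * ℤ.∣ j ∣) ⟩
    σ (ℤ.sign i Sign.* ℤ.sign j) *ᶠ ((ℤ.∣ i ∣ * ℤ.∣ j ∣) ×′ 1#)
      ≈⟨ *-cong (σ-homo-* (ℤ.sign i) (ℤ.sign j)) (×1-homo-* ℤ.∣ i ∣ ℤ.∣ j ∣) ⟩
    (σ (ℤ.sign i) *ᶠ σ (ℤ.sign j)) *ᶠ (ℤ.∣ i ∣ ×′ 1# *ᶠ ℤ.∣ j ∣ ×′ 1#)
      ≈⟨ interchange _ _ _ _ ⟩
    (σ (ℤ.sign i) *ᶠ ℤ.∣ i ∣ ×′ 1#) *ᶠ (σ (ℤ.sign j) *ᶠ ℤ.∣ j ∣ ×′ 1#)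
      ≈⟨ *-cong (⟦⟧-sign i) (⟦⟧-sign j) ⟨
    ⟦ i ⟧ *ᶠ ⟦ j ⟧
      ∎

  ℤ-morphism : ℤ.+-*-rawRing -Raw-AlmostCommutative⟶ fromCommutativeRing F
  ℤ-morphism = record
    { ⟦_⟧ = ⟦_⟧ ; +-homo = ⟦⟧-homo-+ ; *-homo = ⟦⟧-homo-* ; -‿homo = ⟦⟧-homo-neg
    ; 0-homo = refl ; 1-homo = refl }

  ⟦⟧-≟ : ∀ i j → Maybe (⟦ i ⟧ ≈ ⟦ j ⟧)
  ⟦⟧-≟ i j with i ℤ.≟ j
  ... | yes ≡.refl = just refl
  ... | no _       = nothing

  open import Algebra.Solver.Ring ℤ.+-*-rawRing (fromCommutativeRing F) ℤ-morphism ⟦⟧-≟ public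
    using (solve; _:=_; _:+_; _:*_; _:-_; :-_; con)

module Numerals {c r : Level} (F : CommutativeRing c r) where
  open CommutativeRing F renaming (_+_ to _+ᶠ_; _*_ to _*ᶠ_)
  open SetoidReasoning setoid
  open import Algebra.Properties.Semiring.Mult semiring using (×-homo-+; ×1-homo-*) renaming (_×_ to _×ᵤ_)
  open import Algebra.Properties.Semiring.Exp semiring using () renaming (_^_ to _^ᶠ_; ^-homo-* to ^-homo-+)

  natF≡×1 : ∀ n → natF F n ≡ n ×ᵤ 1#
  natF≡×1 zero    = ≡.refl
  natF≡×1 (suc n) = cong (1# +ᶠ_) (natF≡×1 n)

  powF≡^ : ∀ x n → powF F x n ≡ x ^ᶠ n
  powF≡^ x zero    = ≡.refl
  powF≡^ x (suc n) = cong (x *ᶠ_) (powF≡^ x n)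

  natF-homo-+ : ∀ m n → natF F (m + n) ≈ natF F m +ᶠ natF F n
  natF-homo-+ m n rewrite natF≡×1 (m + n) | natF≡×1 m | natF≡×1 n = ×-homo-+ 1# m n

  natF-homo-* : ∀ m n → natF F (m * n) ≈ natF F m *ᶠ natF F n
  natF-homo-* m n rewrite natF≡×1 (m * n) | natF≡×1 m | natF≡×1 n = ×1-homo-* m n

  powF-homo-+ : ∀ x m n → powF F x (m + n) ≈ powF F x m *ᶠ powF F x n
  powF-homo-+ x m n rewrite powF≡^ x (m + n) | powF≡^ x m | powF≡^ x n = ^-homo-+ x m n

  natF-homo-^ : ∀ a n → natF F (a ^ n) ≈ powF F (natF F a) n
  natF-homo-^ a zero    = +-identityʳ 1#
  natF-homo-^ a (suc n) = trans (natF-homo-* a (a ^ n)) (*-congˡ (natF-homo-^ a n))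

  powF-period : ∀ {x n} → powF F x n ≈ 1# → ∀ k → powF F x (k * n) ≈ 1#
  powF-period         xⁿ≈1 zero    = refl
  powF-period {x} {n} xⁿ≈1 (suc k) =
    trans (powF-homo-+ x n (k * n)) (trans (*-cong xⁿ≈1 (powF-period xⁿ≈1 k)) (*-identityˡ 1#))

  powF-mod : ∀ {x n} .{{_ : ℕ.NonZero n}} → powF F x n ≈ 1# → ∀ m → powF F x m ≈ powF F x (m % n)
  powF-mod {x} {n} xⁿ≈1 m = begin
    powF F x m                                  ≡⟨ cong (powF F x) (m≡m%n+[m/n]*n m n) ⟩
    powF F x (m % n + m / n * n)                ≈⟨ powF-homo-+ x (m % n) (m / n * n) ⟩
    powF F x (m % n) *ᶠ powF F x (m / n * n)    ≈⟨ *-congˡ (powF-period xⁿ≈1 (m / n)) ⟩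
    powF F x (m % n) *ᶠ 1#                      ≈⟨ *-identityʳ _ ⟩
    powF F x (m % n)                            ∎

module PrefixSums {c r : Level} (F : CommutativeRing c r) where
  open CommutativeRing F renaming (_+_ to _+ᶠ_; _*_ to _*ᶠ_)
  open import Algebra.Properties.CommutativeSemigroup +-commutativeSemigroup using (xy∙z≈xz∙y)
  open CommutativeRingSolver F using (solve; _:=_; _:+_; _:*_; con)
  open SetoidReasoning setoid

  Σ< : ℕ → (ℕ → Carrier) → Carrier
  Σ< zero    f = 0#
  Σ< (suc n) f = Σ< n f +ᶠ f n

  module _ {f : ℕ → Carrier} {K : ℕ} (f-periodic : ∀ i → f (i + K) ≈ f i) where

    Σ<-+-period : ∀ a → Σ< (a + K) f ≈ Σ< a f +ᶠ Σ< K f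
    Σ<-+-period zero    = sym (+-identityˡ _)
    Σ<-+-period (suc a) = begin
      Σ< (a + K) f +ᶠ f (a + K)       ≈⟨ +-cong (Σ<-+-period a) (f-periodic a) ⟩
      Σ< a f +ᶠ Σ< K f +ᶠ f a         ≈⟨ xy∙z≈xz∙y _ _ _ ⟩
      Σ< a f +ᶠ f a +ᶠ Σ< K f         ∎

    Σ<-*-period : ∀ a j → Σ< (a + j * K) f ≈ Σ< a f +ᶠ natF F j *ᶠ Σ< K f
    Σ<-*-period a zero    = begin
      Σ< (a + 0) f                    ≡⟨ cong (λ n → Σ< n f) (ℕ.+-identityʳ a) ⟩
      Σ< a f                          ≈⟨ +-identityʳ _ ⟨
      Σ< a f +ᶠ 0#                    ≈⟨ +-congˡ (zeroˡ _) ⟨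
      Σ< a f +ᶠ 0# *ᶠ Σ< K f          ∎
    Σ<-*-period a (suc j) = begin
      Σ< (a + (K + j * K)) f                        ≡⟨ cong (λ n → Σ< n f) a+[K+jK]≡a+jK+K ⟩
      Σ< (a + j * K + K) f                          ≈⟨ Σ<-+-period (a + j * K) ⟩
      Σ< (a + j * K) f +ᶠ Σ< K f                    ≈⟨ +-congʳ (Σ<-*-period a j) ⟩
      Σ< a f +ᶠ natF F j *ᶠ Σ< K f +ᶠ Σ< K f
        ≈⟨ solve 3 (λ A n S → A :+ n :* S :+ S := A :+ (con (ℤ.+ 1) :+ n) :* S) refl (Σ< a f) (natF F j) (Σ< K f) ⟩
      Σ< a f +ᶠ natF F (suc j) *ᶠ Σ< K f            ∎
      where
      a+[K+jK]≡a+jK+K : a + (K + j * K) ≡ a + j * K + K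
      a+[K+jK]≡a+jK+K = ≡.trans (cong (a +_) (ℕ.+-comm K (j * K))) (≡.sym (ℕ.+-assoc a (j * K) K))

module Characteristic {c r : Level} (F : CommutativeRing c r) (l : ℕ) (ℓ-prime : Prime (suc (suc l)))
                      (ℓ≈0 : CommutativeRing._≈_ F (natF F (suc (suc l))) (CommutativeRing.0# F)) where
  ℓ : ℕ
  ℓ = suc (suc l)

  open CommutativeRing F renaming (_+_ to _+ᶠ_; _*_ to _*ᶠ_; -_ to -ᶠ_)
  open Numerals F
  open PrefixSums F
  open import Algebra.Properties.Semiring.Exp semiring using () renaming (_^_ to _^ᶠ_)
  open import Algebra.Properties.Semiring.Mult semiring using (×-congʳ; ×-assoc-*) renaming (_×_ to _×ᵤ_)
  open import Algebra.Properties.Monoid.Mult *-monoid using (×-idem)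
  open import Algebra.Properties.Monoid.Sum +-monoid using (sum; sum-init-last; sum-cong-≋; sum-replicate-zero)
  open import Algebra.Properties.CommutativeSemiring.Binomial commutativeSemiring
    using (theorem; binomialTerm)
  open import Algebra.Properties.Ring ring using (+-inverseʳ-unique)
  open SetoidReasoning setoid

  natF-∣ : ∀ {n} → ℓ ∣ n → natF F n ≈ 0#
  natF-∣ (divides k ≡.refl) = trans (natF-homo-* k ℓ) (trans (*-congˡ ℓ≈0) (zeroʳ _))

  natF-mod : ∀ n → natF F n ≈ natF F (n % ℓ)
  natF-mod n = begin
    natF F n                             ≡⟨ cong (natF F) (m≡m%n+[m/n]*n n ℓ) ⟩
    natF F (n % ℓ + n / ℓ * ℓ)           ≈⟨ natF-homo-+ (n % ℓ) (n / ℓ * ℓ) ⟩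
    natF F (n % ℓ) +ᶠ natF F (n / ℓ * ℓ) ≈⟨ +-congˡ (natF-∣ (divides (n / ℓ) ≡.refl)) ⟩
    natF F (n % ℓ) +ᶠ 0#                 ≈⟨ +-identityʳ _ ⟩
    natF F (n % ℓ)                       ∎

  frobenius : ∀ x → powF F (1# +ᶠ x) ℓ ≈ 1# +ᶠ powF F x ℓ
  frobenius x = begin
    powF F (1# +ᶠ x) ℓ                                      ≡⟨ powF≡^ (1# +ᶠ x) ℓ ⟩
    (1# +ᶠ x) ^ᶠ ℓ                                          ≈⟨ theorem ℓ 1# x ⟩
    term Fin.zero +ᶠ sum (λ i → term (Fin.suc i))           ≈⟨ +-congˡ (sum-init-last (λ i → term (Fin.suc i))) ⟩
    term Fin.zero +ᶠ (sum (λ i → term (Fin.suc (inject₁ i))) +ᶠ term (Fin.suc (fromℕ (suc l))))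
      ≈⟨ +-cong first (+-cong (trans (sum-cong-≋ middle) (sum-replicate-zero (suc l))) last) ⟩
    powF F x ℓ +ᶠ (0# +ᶠ 1#)                                ≈⟨ +-congˡ (+-identityˡ _) ⟩
    powF F x ℓ +ᶠ 1#                                        ≈⟨ +-comm _ _ ⟩
    1# +ᶠ powF F x ℓ                                        ∎
    where
    term = binomialTerm 1# x ℓ
    1^ᶠ≈1 : ∀ n → 1# ^ᶠ n ≈ 1#
    1^ᶠ≈1 zero    = refl
    1^ᶠ≈1 (suc n) = ×-idem (*-identityˡ 1#) (suc n)
    first : term Fin.zero ≈ powF F x ℓ
    first = trans (+-identityʳ _) (trans (*-identityˡ _) (reflexive (≡.sym (powF≡^ x ℓ))))
    last : term (Fin.suc (fromℕ (suc l))) ≈ 1#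
    last = begin
      term (Fin.suc (fromℕ (suc l)))
        ≡⟨ cong (λ k → (ℓ C suc k) ×ᵤ (1# ^ᶠ suc k *ᶠ x ^ᶠ (ℓ ∸ suc k))) (Fin.toℕ-fromℕ (suc l)) ⟩
      (ℓ C ℓ) ×ᵤ (1# ^ᶠ ℓ *ᶠ x ^ᶠ (ℓ ∸ ℓ))
        ≡⟨ cong₂ (λ a b → a ×ᵤ (1# ^ᶠ ℓ *ᶠ x ^ᶠ b)) (nCn≡1 ℓ) (ℕ.n∸n≡0 ℓ) ⟩
      1 ×ᵤ (1# ^ᶠ ℓ *ᶠ 1#)  ≈⟨ trans (+-identityʳ _) (trans (*-identityʳ _) (1^ᶠ≈1 ℓ)) ⟩
      1#                    ∎
    middle : ∀ i → term (Fin.suc (inject₁ i)) ≈ 0#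
    middle i = begin
      (ℓ C k) ×ᵤ b          ≈⟨ ×-congʳ (ℓ C k) (*-identityˡ b) ⟨
      (ℓ C k) ×ᵤ (1# *ᶠ b)  ≈⟨ ×-assoc-* (ℓ C k) 1# b ⟨
      (ℓ C k) ×ᵤ 1# *ᶠ b    ≡⟨ cong (_*ᶠ b) (natF≡×1 (ℓ C k)) ⟨
      natF F (ℓ C k) *ᶠ b   ≈⟨ *-congʳ (natF-∣ (prime∣choose ℓ-prime (s≤s z≤n) k<ℓ)) ⟩
      0# *ᶠ b               ≈⟨ zeroˡ b ⟩
      0#                    ∎
      where
      k = toℕ (Fin.suc (inject₁ i))
      b = 1# ^ᶠ k *ᶠ x ^ᶠ (ℓ ∸ k)
      k<ℓ : k < ℓ
      k<ℓ = s≤s (≡.subst (_< suc l) (≡.sym (Fin.toℕ-inject₁ i)) (Fin.toℕ<n i))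

  natF-^ℓ : ∀ a → powF F (natF F a) ℓ ≈ natF F a
  natF-^ℓ zero    = zeroˡ _
  natF-^ℓ (suc a) = trans (frobenius (natF F a)) (+-congˡ (natF-^ℓ a))

  fermat : ∀ {a} → Coprime a ℓ → powF F (natF F a) (suc l) ≈ 1#
  fermat {a} a⊥ℓ with inverse a (suc l) a⊥ℓ
  ... | w , aw≡1 = begin
    powF F u (suc l)                  ≈⟨ *-identityʳ _ ⟨
    powF F u (suc l) *ᶠ 1#            ≈⟨ *-congˡ u*w≈1 ⟨
    powF F u (suc l) *ᶠ (u *ᶠ natF F w) ≈⟨ *-assoc _ _ _ ⟨
    powF F u (suc l) *ᶠ u *ᶠ natF F w ≈⟨ *-congʳ (*-comm _ _) ⟩
    powF F u ℓ *ᶠ natF F w            ≈⟨ *-congʳ (natF-^ℓ a) ⟩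
    u *ᶠ natF F w                     ≈⟨ u*w≈1 ⟩
    1#                                ∎
    where
    u = natF F a
    u*w≈1 : u *ᶠ natF F w ≈ 1#
    u*w≈1 = begin
      u *ᶠ natF F w          ≈⟨ natF-homo-* a w ⟨
      natF F (a * w)         ≈⟨ natF-mod (a * w) ⟩
      natF F ((a * w) % ℓ)   ≡⟨ cong (natF F) aw≡1 ⟩
      natF F 1               ≈⟨ +-identityʳ 1# ⟩
      1#                     ∎

  natF[ℓ∸1]≈-1 : natF F (suc l) ≈ -ᶠ 1#
  natF[ℓ∸1]≈-1 = +-inverseʳ-unique 1# (natF F (suc l)) ℓ≈0

  Σ<-mod : ∀ {f K N} .{{_ : ℕ.NonZero N}} → (∀ i → f (i + K) ≈ f i) → ℓ * K ∣ N →
           ∀ a → Σ< a f ≈ Σ< (a % N) f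
  Σ<-mod {f} {K} {N} f-periodic (divides d N≡dℓK) a = begin
    Σ< a f                                  ≡⟨ cong (λ n → Σ< n f) a≡a%N+jK ⟩
    Σ< (a % N + (a / N * d * ℓ) * K) f      ≈⟨ Σ<-*-period f-periodic (a % N) (a / N * d * ℓ) ⟩
    Σ< (a % N) f +ᶠ natF F (a / N * d * ℓ) *ᶠ Σ< K f
      ≈⟨ +-congˡ (*-congʳ (natF-∣ (divides (a / N * d) ≡.refl))) ⟩
    Σ< (a % N) f +ᶠ 0# *ᶠ Σ< K f            ≈⟨ +-congˡ (zeroˡ _) ⟩
    Σ< (a % N) f +ᶠ 0#                      ≈⟨ +-identityʳ _ ⟩
    Σ< (a % N) f                            ∎
    where
    a≡a%N+jK : a ≡ a % N + (a / N * d * ℓ) * K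
    a≡a%N+jK = ≡.trans (m≡m%n+[m/n]*n a N) (cong (a % N +_) (≡.trans (cong (a / N *_) N≡dℓK)
                 (≡.trans (≡.sym (ℕ.*-assoc (a / N) d (ℓ * K))) (≡.sym (ℕ.*-assoc (a / N * d) ℓ K)))))

-- (a , b) stands for tᵃsᵇ; the multiplication encodes s t s⁻¹ = t^q.
module ℕ⋊ℕ (q : ℕ) where

  infixl 7 _∙_
  _∙_ : ℕ × ℕ → ℕ × ℕ → ℕ × ℕ
  (a , b) ∙ (x , y) = a + q ^ b * x , b + y

  ∙-assoc : ∀ f g h → (f ∙ g) ∙ h ≡ f ∙ (g ∙ h)
  ∙-assoc (a , b) (x , y) (z , w) = cong₂ _,_ first (ℕ.+-assoc b y w)
    where
    open ≡.≡-Reasoning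
    first : a + q ^ b * x + q ^ (b + y) * z ≡ a + q ^ b * (x + q ^ y * z)
    first = begin
      a + q ^ b * x + q ^ (b + y) * z        ≡⟨ ℕ.+-assoc a _ _ ⟩
      a + (q ^ b * x + q ^ (b + y) * z)      ≡⟨ cong (λ n → a + (q ^ b * x + n * z)) (ℕ.^-distribˡ-+-* q b y) ⟩
      a + (q ^ b * x + q ^ b * q ^ y * z)    ≡⟨ cong (λ n → a + (q ^ b * x + n)) (ℕ.*-assoc (q ^ b) (q ^ y) z) ⟩
      a + (q ^ b * x + q ^ b * (q ^ y * z))  ≡⟨ cong (a +_) (ℕ.*-distribˡ-+ (q ^ b) x (q ^ y * z)) ⟨
      a + q ^ b * (x + q ^ y * z)            ∎

  ∙-identityʳ : ∀ f → f ∙ (0 , 0) ≡ f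
  ∙-identityʳ (a , b) = cong₂ _,_ (≡.trans (cong (a +_) (ℕ.*-zeroʳ (q ^ b))) (ℕ.+-identityʳ a)) (ℕ.+-identityʳ b)

  [a,0]∙[x,y]≡[a+x,y] : ∀ a x y → (a , 0) ∙ (x , y) ≡ (a + x , y)
  [a,0]∙[x,y]≡[a+x,y] a x y = cong (λ n → a + n , y) (ℕ.*-identityˡ x)

  [a,b]∙[0,y]≡[a,b+y] : ∀ a b y → (a , b) ∙ (0 , y) ≡ (a , b + y)
  [a,b]∙[0,y]≡[a,b+y] a b y = cong (_, b + y) (≡.trans (cong (a +_) (ℕ.*-zeroʳ (q ^ b))) (ℕ.+-identityʳ a))

  -- Close n hn m (ι a , ι b) (ι x , ι y) in Ḡ_q reduces to Closeᴹ n m (a , b) (x , y).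
  Closeᴹ : ℕ → ℕ → ℕ × ℕ → ℕ × ℕ → Set
  Closeᴹ n m (a , b) (x , y) = (a % suc n ≡ x % suc n) × (b % suc m ≡ y % suc m)

module ℕ⋊ℕ-Cohomology (p k l : ℕ) {c r : Level} (F : CommutativeRing c r)
  (p-prime : Prime p) (ℓ-prime : Prime (suc (suc l))) (ℓ≢p : ¬ (suc (suc l) ≡ p))
  (ℓ≈0 : CommutativeRing._≈_ F (natF F (suc (suc l))) (CommutativeRing.0# F)) where

  open Coh p k (suc (suc l)) F
  open CommutativeRing F
    using (refl; sym; trans; reflexive; setoid; +-cong; +-congˡ; +-congʳ; *-cong; *-congˡ; *-congʳ; -‿cong;
           zeroˡ; zeroʳ; +-identityˡ; +-identityʳ; *-identityˡ; *-identityʳ)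
  open import Algebra.Properties.Ring (CommutativeRing.ring F)
    using (-0#≈0#; -‿involutive; -1*x≈-x; x∙y⁻¹≈ε⇒x≈y; x≈y⇒x∙y⁻¹≈ε)
  open CommutativeRingSolver F using (solve; _:=_; _:+_; _:*_; _:-_; :-_; con)
  open Numerals F
  open PrefixSums F using (Σ<)
  open Characteristic F l ℓ-prime ℓ≈0
  open ℕ⋊ℕ q public
  open SetoidReasoning setoid

  u : Carrier
  u = natF F q

  q⊥ℓ : Coprime q ℓ
  q⊥ℓ = Coprime.sym (coprime-^ k (coprime-primes ℓ-prime p-prime ℓ≢p))

  u^[ℓ∸1]≈1 : powF F u (suc l) ≈ 1#
  u^[ℓ∸1]≈1 = fermat q⊥ℓ

  infixr 8 _▸_
  _▸_ : ℕ × ℕ → Carrier → Carrier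
  (a , b) ▸ x = powF F u b *ᶠ x

  ▸-homo : ∀ f g x → (f ∙ g) ▸ x ≈ f ▸ g ▸ x
  ▸-homo (a , b) (x , y) z = trans (*-congʳ (powF-homo-+ u b y)) (CommutativeRing.*-assoc F _ _ _)

  ▸-zero : ∀ f {x} → x ≈ 0# → f ▸ x ≈ 0#
  ▸-zero f x≈0 = trans (*-congˡ x≈0) (zeroʳ _)

  Cochainᴹ₁ : Set c
  Cochainᴹ₁ = ℕ × ℕ → Carrier

  Cochainᴹ₂ : Set c
  Cochainᴹ₂ = ℕ × ℕ → ℕ × ℕ → Carrier

  δᴹ : Cochainᴹ₂ → ℕ × ℕ → ℕ × ℕ → ℕ × ℕ → Carrier
  δᴹ γ f g h = f ▸ γ g h − γ (f ∙ g) h +ᶠ γ f (g ∙ h) − γ f g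

  IsCocycleᴹ : Cochainᴹ₂ → Set r
  IsCocycleᴹ γ = ∀ f g h → δᴹ γ f g h ≈ 0#

  ∂ᴹ : Cochainᴹ₁ → Cochainᴹ₂
  ∂ᴹ φ f g = f ▸ φ g − φ (f ∙ g) +ᶠ φ f

  _⊖ᴹ_ : Cochainᴹ₂ → Cochainᴹ₂ → Cochainᴹ₂
  (γ ⊖ᴹ δ) f g = γ f g − δ f g

  Φᴹ : Cochainᴹ₂ → Carrier
  Φᴹ γ = Σ₁ (q ^ suc l ∸ 1) (λ i → γ (i , 0) (1 , 0)) +ᶠ γ (q ^ suc l , 0) (0 , suc l) − γ (0 , suc l) (1 , 0)

  ∂ᴹ-isCocycle : ∀ φ → IsCocycleᴹ (∂ᴹ φ)
  ∂ᴹ-isCocycle φ f g h = begin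
    δᴹ (∂ᴹ φ) f g h
      ≈⟨ +-congʳ (+-congʳ (+-congˡ (-‿cong (+-congʳ (+-cong (▸-homo f g (φ h))
                                                           (-‿cong (reflexive (cong φ (∙-assoc f g h))))))))) ⟩
    f ▸ ∂ᴹ φ g h − (f ▸ g ▸ φ h − φ (f ∙ (g ∙ h)) +ᶠ φ (f ∙ g)) +ᶠ ∂ᴹ φ f (g ∙ h) − ∂ᴹ φ f g
      ≈⟨ solve 8 (λ U G x y z w v o → U :* (G :* x :- y :+ z) :- (U :* (G :* x) :- w :+ v)
                                        :+ (U :* y :- w :+ o) :- (U :* z :- v :+ o) := con (ℤ.+ 0))
               refl (powF F u (proj₂ f)) (powF F u (proj₂ g)) (φ h) (φ (g ∙ h)) (φ g)
               (φ (f ∙ (g ∙ h))) (φ (f ∙ g)) (φ f) ⟩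
    0# ∎

  ⊖ᴹ-isCocycle : ∀ {γ δ} → IsCocycleᴹ γ → IsCocycleᴹ δ → IsCocycleᴹ (γ ⊖ᴹ δ)
  ⊖ᴹ-isCocycle {γ} {δ} γ-cocycle δ-cocycle f g h = begin
    δᴹ (γ ⊖ᴹ δ) f g h              ≈⟨ solve 9 (λ U a a′ b b′ c c′ d d′ →
                                         U :* (a :- a′) :- (b :- b′) :+ (c :- c′) :- (d :- d′)
                                           := (U :* a :- b :+ c :- d) :- (U :* a′ :- b′ :+ c′ :- d′))
                                       refl (powF F u (proj₂ f)) (γ g h) (δ g h) (γ (f ∙ g) h) (δ (f ∙ g) h)
                                       (γ f (g ∙ h)) (δ f (g ∙ h)) (γ f g) (δ f g) ⟩
    δᴹ γ f g h − δᴹ δ f g h        ≈⟨ +-cong (γ-cocycle f g h) (-‿cong (δ-cocycle f g h)) ⟩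
    0# − 0#                        ≈⟨ trans (+-congˡ -0#≈0#) (+-identityʳ 0#) ⟩
    0#                             ∎

  Σ₁-cong : ∀ n {f g} → (∀ i → f i ≈ g i) → Σ₁ n f ≈ Σ₁ n g
  Σ₁-cong zero    f≈g = refl
  Σ₁-cong (suc n) f≈g = +-cong (Σ₁-cong n f≈g) (f≈g (suc n))

  Σ₁-zero : ∀ n {f} → (∀ i → f i ≈ 0#) → Σ₁ n f ≈ 0#
  Σ₁-zero zero    f≈0 = refl
  Σ₁-zero (suc n) f≈0 = trans (+-cong (Σ₁-zero n f≈0) (f≈0 (suc n))) (+-identityʳ 0#)

  Σ₁-homo-+ : ∀ n (f g : ℕ → Carrier) → Σ₁ n (λ i → f i +ᶠ g i) ≈ Σ₁ n f +ᶠ Σ₁ n g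
  Σ₁-homo-+ zero    f g = sym (+-identityʳ 0#)
  Σ₁-homo-+ (suc n) f g = trans (+-congʳ (Σ₁-homo-+ n f g))
    (solve 4 (λ a b x y → a :+ b :+ (x :+ y) := a :+ x :+ (b :+ y)) refl _ _ (f (suc n)) (g (suc n)))

  Σ₁-homo-* : ∀ n x (f : ℕ → Carrier) → Σ₁ n (λ i → x *ᶠ f i) ≈ x *ᶠ Σ₁ n f
  Σ₁-homo-* zero    x f = sym (zeroʳ x)
  Σ₁-homo-* (suc n) x f = trans (+-congʳ (Σ₁-homo-* n x f))
    (solve 3 (λ x a b → x :* a :+ x :* b := x :* (a :+ b)) refl x _ (f (suc n)))

  Σ₁-homo-− : ∀ n (f g : ℕ → Carrier) → Σ₁ n (λ i → f i − g i) ≈ Σ₁ n f − Σ₁ n g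
  Σ₁-homo-− zero    f g = sym (trans (+-congˡ -0#≈0#) (+-identityʳ 0#))
  Σ₁-homo-− (suc n) f g = trans (+-congʳ (Σ₁-homo-− n f g))
    (solve 4 (λ a b x y → a :- b :+ (x :- y) := a :+ x :- (b :+ y)) refl _ _ (f (suc n)) (g (suc n)))

  Σ₁-telescope : ∀ n x (g : ℕ → Carrier) →
                 Σ₁ n (λ i → x − g (suc i) +ᶠ g i) ≈ natF F n *ᶠ x − g (suc n) +ᶠ g 1
  Σ₁-telescope zero    x g = solve 2 (λ x y → con (ℤ.+ 0) := con (ℤ.+ 0) :* x :- y :+ y) refl x (g 1)
  Σ₁-telescope (suc n) x g = trans (+-congʳ (Σ₁-telescope n x g))
    (solve 5 (λ N x g₁ g₂ g₃ → N :* x :- g₂ :+ g₁ :+ (x :- g₃ :+ g₂) := (con (ℤ.+ 1) :+ N) :* x :- g₃ :+ g₁)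
           refl (natF F n) x (g 1) (g (suc n)) (g (suc (suc n))))

  Φᴹ-cong : ∀ {γ δ} → (∀ f g → γ f g ≈ δ f g) → Φᴹ γ ≈ Φᴹ δ
  Φᴹ-cong γ≈δ =
    +-cong (+-cong (Σ₁-cong (q ^ suc l ∸ 1) (λ i → γ≈δ (i , 0) (1 , 0))) (γ≈δ _ _)) (-‿cong (γ≈δ _ _))

  ∂ᴹ-cong : ∀ {φ ψ} → (∀ f → φ f ≈ ψ f) → ∀ f g → ∂ᴹ φ f g ≈ ∂ᴹ ψ f g
  ∂ᴹ-cong φ≈ψ f g = +-cong (+-cong (*-congˡ (φ≈ψ g)) (-‿cong (φ≈ψ (f ∙ g)))) (φ≈ψ f)

  Φᴹ-homo-⊖ : ∀ γ δ → Φᴹ (γ ⊖ᴹ δ) ≈ Φᴹ γ − Φᴹ δ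
  Φᴹ-homo-⊖ γ δ =
    trans (+-congʳ (+-congʳ (Σ₁-homo-− (q ^ suc l ∸ 1) (λ i → γ (i , 0) (1 , 0)) (λ i → δ (i , 0) (1 , 0)))))
    (solve 6 (λ a b x y z w → a :- b :+ (x :- y) :- (z :- w) := (a :+ x :- z) :- (b :+ y :- w)) refl _ _ _ _ _ _)

  Φᴹ-∂ᴹ : ∀ φ → Φᴹ (∂ᴹ φ) ≈ 0#
  Φᴹ-∂ᴹ φ = begin
    Φᴹ (∂ᴹ φ)                                   ≈⟨ +-cong (+-cong t-terms ts-term) (-‿cong st-term) ⟩
    (N *ᶠ x − φ (Q , 0) +ᶠ x) +ᶠ (φ (0 , suc l) − φ (Q , suc l) +ᶠ φ (Q , 0))
      − (U *ᶠ x − φ (Q , suc l) +ᶠ φ (0 , suc l))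
                                                ≈⟨ solve 6 (λ N x A B C U → N :* x :- A :+ x :+ (B :- C :+ A) :- (U :* x :- C :+ B)
                                                                              := (con (ℤ.+ 1) :+ N :- U) :* x)
                                                         refl N x (φ (Q , 0)) (φ (0 , suc l)) (φ (Q , suc l)) U ⟩
    (1# +ᶠ N − U) *ᶠ x                          ≈⟨ *-congʳ (+-congʳ 1+N≈U) ⟩
    (U − U) *ᶠ x                                ≈⟨ solve 2 (λ U x → (U :- U) :* x := con (ℤ.+ 0)) refl U x ⟩
    0#                                          ∎
    where
    instance _ = ℕ.m^n≢0 q (suc l) {{ℕ.m^n≢0 p k {{prime⇒nonZero p-prime}}}}
    Q = q ^ suc l
    N = natF F (Q ∸ 1)
    U = powF F u (suc l)
    x = φ (1 , 0)
    φ-at : ∀ {f g} → f ≡ g → φ f ≈ φ g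
    φ-at f≡g = reflexive (cong φ f≡g)
    1+N≈U : 1# +ᶠ N ≈ U
    1+N≈U = trans (reflexive (cong (natF F) (ℕ.suc-pred Q))) (natF-homo-^ q (suc l))
    t-terms : Σ₁ (Q ∸ 1) (λ i → ∂ᴹ φ (i , 0) (1 , 0)) ≈ N *ᶠ x − φ (Q , 0) +ᶠ x
    t-terms = begin
      Σ₁ (Q ∸ 1) (λ i → ∂ᴹ φ (i , 0) (1 , 0))           ≈⟨ Σ₁-cong (Q ∸ 1) (λ i → +-congʳ (+-cong (*-identityˡ x)
                                                              (-‿cong (φ-at (cong (_, 0) (ℕ.+-comm i 1)))))) ⟩
      Σ₁ (Q ∸ 1) (λ i → x − φ (suc i , 0) +ᶠ φ (i , 0)) ≈⟨ Σ₁-telescope (Q ∸ 1) x (λ i → φ (i , 0)) ⟩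
      N *ᶠ x − φ (suc (Q ∸ 1) , 0) +ᶠ x                 ≡⟨ cong (λ n → N *ᶠ x − φ (n , 0) +ᶠ x) (ℕ.suc-pred Q) ⟩
      N *ᶠ x − φ (Q , 0) +ᶠ x                           ∎
    ts-term : ∂ᴹ φ (Q , 0) (0 , suc l) ≈ φ (0 , suc l) − φ (Q , suc l) +ᶠ φ (Q , 0)
    ts-term = +-congʳ (+-cong (*-identityˡ _) (-‿cong (φ-at ([a,b]∙[0,y]≡[a,b+y] Q 0 (suc l)))))
    st-term : ∂ᴹ φ (0 , suc l) (1 , 0) ≈ U *ᶠ x − φ (Q , suc l) +ᶠ φ (0 , suc l)
    st-term = +-congʳ (+-congˡ (-‿cong (φ-at (cong₂ _,_ (ℕ.*-identityʳ Q) (ℕ.+-identityʳ (suc l))))))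

  third≈second+fourth : ∀ {a b c d} → a − b +ᶠ c − d ≈ 0# → a ≈ 0# → c ≈ b +ᶠ d
  third≈second+fourth {a} {b} {c} {d} δ≈0 a≈0 = begin
    c                                  ≈⟨ solve 4 (λ a b c d → c := (a :- b :+ c :- d) :+ (b :+ d) :- a) refl a b c d ⟩
    (a − b +ᶠ c − d) +ᶠ (b +ᶠ d) − a   ≈⟨ +-cong (+-congʳ δ≈0) (-‿cong a≈0) ⟩
    0# +ᶠ (b +ᶠ d) − 0#                ≈⟨ solve 2 (λ b d → con (ℤ.+ 0) :+ (b :+ d) :- con (ℤ.+ 0) := b :+ d) refl b d ⟩
    b +ᶠ d                             ∎

  second≈first+third : ∀ {a b c d} → a − b +ᶠ c − d ≈ 0# → d ≈ 0# → b ≈ a +ᶠ c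
  second≈first+third {a} {b} {c} {d} δ≈0 d≈0 = begin
    b                                  ≈⟨ solve 4 (λ a b c d → b := (a :+ c :- d) :- (a :- b :+ c :- d)) refl a b c d ⟩
    (a +ᶠ c − d) − (a − b +ᶠ c − d)    ≈⟨ +-cong (+-congˡ (-‿cong d≈0)) (-‿cong δ≈0) ⟩
    (a +ᶠ c − 0#) − 0#                 ≈⟨ solve 2 (λ a c → a :+ c :- con (ℤ.+ 0) :- con (ℤ.+ 0) := a :+ c) refl a c ⟩
    a +ᶠ c                             ∎

  second≈first : ∀ {a b c} → a − b +ᶠ c − c ≈ 0# → b ≈ a
  second≈first {a} {b} {c} δ≈0 = begin
    b                                  ≈⟨ solve 3 (λ a b c → b := a :- (a :- b :+ c :- c)) refl a b c ⟩
    a − (a − b +ᶠ c − c)               ≈⟨ +-congˡ (-‿cong δ≈0) ⟩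
    a − 0#                             ≈⟨ trans (+-congˡ -0#≈0#) (+-identityʳ a) ⟩
    a                                  ∎

  γ-cocycle⇒γ[f,1]≈0 : ∀ {γ} → IsCocycleᴹ γ → γ (0 , 0) (0 , 0) ≈ 0# → ∀ f → γ f (0 , 0) ≈ 0#
  γ-cocycle⇒γ[f,1]≈0 {γ} γ-cocycle γ[1,1]≈0 f = begin
    γ f (0 , 0)               ≡⟨ cong (λ g → γ g (0 , 0)) (∙-identityʳ f) ⟨
    γ (f ∙ (0 , 0)) (0 , 0)   ≈⟨ second≈first (γ-cocycle f (0 , 0) (0 , 0)) ⟩
    f ▸ γ (0 , 0) (0 , 0)     ≈⟨ ▸-zero f γ[1,1]≈0 ⟩
    0#                        ∎

  module Vanishing (γ : Cochainᴹ₂) (γ-cocycle : IsCocycleᴹ γ)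
                   (γ[tᵃ,sᵇ]≈0 : ∀ a b → γ (a , 0) (0 , b) ≈ 0#)
                   (γ[tᵃ,t]≈0 : ∀ a → γ (a , 0) (1 , 0) ≈ 0#)
                   (γ[sᵇ,s]≈0 : ∀ b → γ (0 , b) (0 , 1) ≈ 0#) where

    γ-at : ∀ {f f′ g g′} → f ≡ f′ → g ≡ g′ → γ f g ≈ γ f′ g′
    γ-at f≡f′ g≡g′ = reflexive (cong₂ γ f≡f′ g≡g′)

    0+0≈0 : 0# +ᶠ 0# ≈ 0#
    0+0≈0 = +-identityʳ 0#

    γ[f,1]≈0 : ∀ f → γ f (0 , 0) ≈ 0#
    γ[f,1]≈0 = γ-cocycle⇒γ[f,1]≈0 γ-cocycle (γ[tᵃ,sᵇ]≈0 0 0)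

    γ[tᵃ,tˣ]≈0 : ∀ a x → γ (a , 0) (x , 0) ≈ 0#
    γ[tᵃ,tˣ]≈0 a zero    = γ[tᵃ,sᵇ]≈0 a 0
    γ[tᵃ,tˣ]≈0 a (suc x) = begin
      γ (a , 0) (suc x , 0)                               ≈⟨ γ-at ≡.refl (cong (_, 0) (ℕ.+-comm 1 x)) ⟩
      γ (a , 0) ((x , 0) ∙ (1 , 0))                       ≈⟨ third≈second+fourth (γ-cocycle (a , 0) (x , 0) (1 , 0))
                                                                                  (▸-zero (a , 0) (γ[tᵃ,t]≈0 x)) ⟩
      γ ((a , 0) ∙ (x , 0)) (1 , 0) +ᶠ γ (a , 0) (x , 0)  ≈⟨ +-cong (γ[tᵃ,t]≈0 _) (γ[tᵃ,tˣ]≈0 a x) ⟩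
      0# +ᶠ 0#                                            ≈⟨ 0+0≈0 ⟩
      0#                                                  ∎

    γ[tᵃ,tˣsʸ]≈0 : ∀ a x y → γ (a , 0) (x , y) ≈ 0#
    γ[tᵃ,tˣsʸ]≈0 a x y = begin
      γ (a , 0) (x , y)                                   ≈⟨ γ-at ≡.refl ([a,b]∙[0,y]≡[a,b+y] x 0 y) ⟨
      γ (a , 0) ((x , 0) ∙ (0 , y))                       ≈⟨ third≈second+fourth (γ-cocycle (a , 0) (x , 0) (0 , y))
                                                                                  (▸-zero (a , 0) (γ[tᵃ,sᵇ]≈0 x y)) ⟩
      γ ((a , 0) ∙ (x , 0)) (0 , y) +ᶠ γ (a , 0) (x , 0)  ≈⟨ +-cong (γ[tᵃ,sᵇ]≈0 _ y) (γ[tᵃ,tˣ]≈0 a x) ⟩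
      0# +ᶠ 0#                                            ≈⟨ 0+0≈0 ⟩
      0#                                                  ∎

    γ[tᵃsᵇ,s]≈0 : ∀ a b → γ (a , b) (0 , 1) ≈ 0#
    γ[tᵃsᵇ,s]≈0 a b = begin
      γ (a , b) (0 , 1)                                   ≈⟨ γ-at ([a,b]∙[0,y]≡[a,b+y] a 0 b) ≡.refl ⟨
      γ ((a , 0) ∙ (0 , b)) (0 , 1)                       ≈⟨ second≈first+third (γ-cocycle (a , 0) (0 , b) (0 , 1))
                                                                                 (γ[tᵃ,sᵇ]≈0 a b) ⟩
      (a , 0) ▸ γ (0 , b) (0 , 1) +ᶠ γ (a , 0) ((0 , b) ∙ (0 , 1))
                                                          ≈⟨ +-cong (▸-zero (a , 0) (γ[sᵇ,s]≈0 b))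
                                                                    (trans (γ-at ≡.refl ([a,b]∙[0,y]≡[a,b+y] 0 b 1)) (γ[tᵃ,sᵇ]≈0 a _)) ⟩
      0# +ᶠ 0#                                            ≈⟨ 0+0≈0 ⟩
      0#                                                  ∎

    γ[tᵃsᵇ,sʸ]≈0 : ∀ a b y → γ (a , b) (0 , y) ≈ 0#
    γ[tᵃsᵇ,sʸ]≈0 a b zero    = γ[f,1]≈0 (a , b)
    γ[tᵃsᵇ,sʸ]≈0 a b (suc y) = begin
      γ (a , b) (0 , suc y)                               ≈⟨ γ-at ≡.refl (≡.trans (cong (_, suc y) (≡.sym (ℕ.*-zeroʳ (q ^ y))))
                                                                                   (cong (q ^ y * 0 ,_) (ℕ.+-comm 1 y))) ⟩
      γ (a , b) ((0 , y) ∙ (0 , 1))                       ≈⟨ third≈second+fourth (γ-cocycle (a , b) (0 , y) (0 , 1))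
                                                                                  (▸-zero (a , b) (γ[sᵇ,s]≈0 y)) ⟩
      γ ((a , b) ∙ (0 , y)) (0 , 1) +ᶠ γ (a , b) (0 , y)  ≈⟨ +-cong (γ[tᵃsᵇ,s]≈0 _ _) (γ[tᵃsᵇ,sʸ]≈0 a b y) ⟩
      0# +ᶠ 0#                                            ≈⟨ 0+0≈0 ⟩
      0#                                                  ∎

    γ[tᵃsᵇ,tˣ]≈γ[sᵇ,tˣ] : ∀ a b x → γ (a , b) (x , 0) ≈ γ (0 , b) (x , 0)
    γ[tᵃsᵇ,tˣ]≈γ[sᵇ,tˣ] a b x = begin
      γ (a , b) (x , 0)                                   ≈⟨ γ-at ([a,b]∙[0,y]≡[a,b+y] a 0 b) ≡.refl ⟨
      γ ((a , 0) ∙ (0 , b)) (x , 0)                       ≈⟨ second≈first+third (γ-cocycle (a , 0) (0 , b) (x , 0))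
                                                                                 (γ[tᵃ,sᵇ]≈0 a b) ⟩
      (a , 0) ▸ γ (0 , b) (x , 0) +ᶠ γ (a , 0) ((0 , b) ∙ (x , 0))
                                                          ≈⟨ +-cong (*-identityˡ _) (γ[tᵃ,tˣsʸ]≈0 a _ _) ⟩
      γ (0 , b) (x , 0) +ᶠ 0#                             ≈⟨ +-identityʳ _ ⟩
      γ (0 , b) (x , 0)                                   ∎

    D : ℕ → Carrier
    D b = γ (0 , b) (1 , 0)

    γ[sᵇ,tˣ]≈x·D : ∀ b x → γ (0 , b) (x , 0) ≈ natF F x *ᶠ D b
    γ[sᵇ,tˣ]≈x·D b zero    = trans (γ[f,1]≈0 (0 , b)) (sym (zeroˡ _))
    γ[sᵇ,tˣ]≈x·D b (suc x) = begin
      γ (0 , b) (suc x , 0)                               ≈⟨ γ-at ≡.refl (cong (_, 0) (ℕ.+-comm 1 x)) ⟩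
      γ (0 , b) ((x , 0) ∙ (1 , 0))                       ≈⟨ third≈second+fourth (γ-cocycle (0 , b) (x , 0) (1 , 0))
                                                                                  (▸-zero (0 , b) (γ[tᵃ,t]≈0 x)) ⟩
      γ ((0 , b) ∙ (x , 0)) (1 , 0) +ᶠ γ (0 , b) (x , 0)  ≈⟨ +-cong (trans (γ[tᵃsᵇ,tˣ]≈γ[sᵇ,tˣ] _ _ 1)
                                                                           (γ-at (cong (0 ,_) (ℕ.+-identityʳ b)) ≡.refl))
                                                                    (γ[sᵇ,tˣ]≈x·D b x) ⟩
      D b +ᶠ natF F x *ᶠ D b                              ≈⟨ solve 2 (λ d n → d :+ n :* d := (con (ℤ.+ 1) :+ n) :* d)
                                                                   refl (D b) (natF F x) ⟩
      natF F (suc x) *ᶠ D b                               ∎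

    γ[tᵃsᵇ,tˣsʸ]≈γ[tᵃsᵇ,tˣ] : ∀ a b x y → γ (a , b) (x , y) ≈ γ (a , b) (x , 0)
    γ[tᵃsᵇ,tˣsʸ]≈γ[tᵃsᵇ,tˣ] a b x y = begin
      γ (a , b) (x , y)                                   ≈⟨ γ-at ≡.refl ([a,b]∙[0,y]≡[a,b+y] x 0 y) ⟨
      γ (a , b) ((x , 0) ∙ (0 , y))                       ≈⟨ third≈second+fourth (γ-cocycle (a , b) (x , 0) (0 , y))
                                                                                  (▸-zero (a , b) (γ[tᵃ,sᵇ]≈0 x y)) ⟩
      γ ((a , b) ∙ (x , 0)) (0 , y) +ᶠ γ (a , b) (x , 0)  ≈⟨ +-congʳ (γ[tᵃsᵇ,sʸ]≈0 _ _ y) ⟩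
      0# +ᶠ γ (a , b) (x , 0)                             ≈⟨ +-identityˡ _ ⟩
      γ (a , b) (x , 0)                                   ∎

    γ≈x·D : ∀ a b x y → γ (a , b) (x , y) ≈ natF F x *ᶠ D b
    γ≈x·D a b x y =
      trans (γ[tᵃsᵇ,tˣsʸ]≈γ[tᵃsᵇ,tˣ] a b x y) (trans (γ[tᵃsᵇ,tˣ]≈γ[sᵇ,tˣ] a b x) (γ[sᵇ,tˣ]≈x·D b x))

    D-suc : ∀ b → D (suc b) ≈ u *ᶠ D b +ᶠ powF F u b *ᶠ D 1
    D-suc b = begin
      D (suc b)                                         ≈⟨ γ-at (cong (_, suc b) (≡.sym (ℕ.*-zeroʳ (q ^ 1)))) ≡.refl ⟩
      γ ((0 , 1) ∙ (0 , b)) (1 , 0)                     ≈⟨ second≈first+third (γ-cocycle (0 , 1) (0 , b) (1 , 0))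
                                                                               (γ[tᵃsᵇ,sʸ]≈0 0 1 b) ⟩
      (0 , 1) ▸ D b +ᶠ γ (0 , 1) ((0 , b) ∙ (1 , 0))    ≈⟨ +-cong (*-congʳ (*-identityʳ u)) (γ≈x·D 0 1 _ _) ⟩
      u *ᶠ D b +ᶠ natF F (q ^ b * 1) *ᶠ D 1             ≈⟨ +-congˡ (*-congʳ q^b≈u^b) ⟩
      u *ᶠ D b +ᶠ powF F u b *ᶠ D 1                     ∎
      where
      q^b≈u^b : natF F (q ^ b * 1) ≈ powF F u b
      q^b≈u^b = trans (reflexive (cong (natF F) (ℕ.*-identityʳ (q ^ b)))) (natF-homo-^ q b)

    u·D : ∀ b → u *ᶠ D b ≈ natF F b *ᶠ (powF F u b *ᶠ D 1)
    u·D zero    = trans (*-congˡ (γ[tᵃ,t]≈0 0)) (trans (zeroʳ u) (sym (zeroˡ _)))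
    u·D (suc b) = begin
      u *ᶠ D (suc b)                                       ≈⟨ *-congˡ (D-suc b) ⟩
      u *ᶠ (u *ᶠ D b +ᶠ powF F u b *ᶠ D 1)                 ≈⟨ solve 4 (λ u a w d → u :* (a :+ w :* d) := u :* a :+ u :* w :* d)
                                                                  refl u (u *ᶠ D b) (powF F u b) (D 1) ⟩
      u *ᶠ (u *ᶠ D b) +ᶠ u *ᶠ powF F u b *ᶠ D 1            ≈⟨ +-congʳ (*-congˡ (u·D b)) ⟩
      u *ᶠ (natF F b *ᶠ (powF F u b *ᶠ D 1)) +ᶠ u *ᶠ powF F u b *ᶠ D 1
        ≈⟨ solve 4 (λ u n w d → u :* (n :* (w :* d)) :+ u :* w :* d := (con (ℤ.+ 1) :+ n) :* (u :* w :* d))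
                 refl u (natF F b) (powF F u b) (D 1) ⟩
      natF F (suc b) *ᶠ (powF F u (suc b) *ᶠ D 1)          ∎

    D[ℓ∸1]≈0⇒D1≈0 : D (suc l) ≈ 0# → D 1 ≈ 0#
    D[ℓ∸1]≈0⇒D1≈0 D[ℓ∸1]≈0 = begin
      D 1                   ≈⟨ -‿involutive (D 1) ⟨
      -ᶠ (-ᶠ D 1)           ≈⟨ -‿cong -D1≈0 ⟩
      -ᶠ 0#                 ≈⟨ -0#≈0# ⟩
      0#                    ∎
      where
      -D1≈0 : -ᶠ D 1 ≈ 0#
      -D1≈0 = begin
        -ᶠ D 1                                     ≈⟨ -1*x≈-x (D 1) ⟨
        -ᶠ 1# *ᶠ D 1                               ≈⟨ *-cong (sym natF[ℓ∸1]≈-1) (sym (*-identityˡ (D 1))) ⟩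
        natF F (suc l) *ᶠ (1# *ᶠ D 1)              ≈⟨ *-congˡ (*-congʳ u^[ℓ∸1]≈1) ⟨
        natF F (suc l) *ᶠ (powF F u (suc l) *ᶠ D 1) ≈⟨ u·D (suc l) ⟨
        u *ᶠ D (suc l)                             ≈⟨ *-congˡ D[ℓ∸1]≈0 ⟩
        u *ᶠ 0#                                    ≈⟨ zeroʳ u ⟩
        0#                                         ∎

    D≈0 : D 1 ≈ 0# → ∀ b → D b ≈ 0#
    D≈0 D1≈0 zero    = γ[tᵃ,t]≈0 0
    D≈0 D1≈0 (suc b) = begin
      D (suc b)                          ≈⟨ D-suc b ⟩
      u *ᶠ D b +ᶠ powF F u b *ᶠ D 1      ≈⟨ +-cong (*-congˡ (D≈0 D1≈0 b)) (*-congˡ D1≈0) ⟩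
      u *ᶠ 0# +ᶠ powF F u b *ᶠ 0#        ≈⟨ trans (+-cong (zeroʳ u) (zeroʳ _)) 0+0≈0 ⟩
      0#                                 ∎

    Φᴹ≈-D[ℓ∸1] : Φᴹ γ ≈ -ᶠ D (suc l)
    Φᴹ≈-D[ℓ∸1] = trans (+-congʳ (+-cong (Σ₁-zero (q ^ suc l ∸ 1) γ[tᵃ,t]≈0) (γ[tᵃ,sᵇ]≈0 _ _)))
                       (trans (+-congʳ 0+0≈0) (+-identityˡ _))

    vanish : Φᴹ γ ≈ 0# → ∀ f g → γ f g ≈ 0#
    vanish Φᴹγ≈0 (a , b) (x , y) = begin
      γ (a , b) (x , y)       ≈⟨ γ≈x·D a b x y ⟩
      natF F x *ᶠ D b         ≈⟨ *-congˡ (D≈0 (D[ℓ∸1]≈0⇒D1≈0 D[ℓ∸1]≈0) b) ⟩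
      natF F x *ᶠ 0#          ≈⟨ zeroʳ _ ⟩
      0#                      ∎
      where
      D[ℓ∸1]≈0 : D (suc l) ≈ 0#
      D[ℓ∸1]≈0 = begin
        D (suc l)             ≈⟨ -‿involutive _ ⟨
        -ᶠ (-ᶠ D (suc l))     ≈⟨ -‿cong (trans (sym Φᴹ≈-D[ℓ∸1]) Φᴹγ≈0) ⟩
        -ᶠ 0#                 ≈⟨ -0#≈0# ⟩
        0#                    ∎

  module Trivialisation (γ : Cochainᴹ₂) (γ-cocycle : IsCocycleᴹ γ)
                        (γ[1,g]≈0 : ∀ g → γ (0 , 0) g ≈ 0#) (γ[f,1]≈0 : ∀ f → γ f (0 , 0) ≈ 0#) where

    P : ℕ → Carrier
    P a = Σ< a (λ i → γ (i , 0) (1 , 0))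

    R : ℕ → Carrier
    R b = Σ< b (λ j → γ (0 , j) (0 , 1))

    -- Chosen so that γ - ∂ᴹ φ₀ satisfies the hypotheses of Vanishing.
    φ₀ : Cochainᴹ₁
    φ₀ (a , b) = -ᶠ (P a +ᶠ R b +ᶠ γ (a , 0) (0 , b))

    P1≈0 : P 1 ≈ 0#
    P1≈0 = trans (+-identityˡ _) (γ[1,g]≈0 (1 , 0))

    R1≈0 : R 1 ≈ 0#
    R1≈0 = trans (+-identityˡ _) (γ[1,g]≈0 (0 , 1))

    φ₀[a,0]≈-P : ∀ a → φ₀ (a , 0) ≈ -ᶠ P a
    φ₀[a,0]≈-P a = -‿cong (trans (+-cong (+-identityʳ (P a)) (γ[f,1]≈0 (a , 0))) (+-identityʳ (P a)))

    φ₀[0,b]≈-R : ∀ b → φ₀ (0 , b) ≈ -ᶠ R b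
    φ₀[0,b]≈-R b = -‿cong (trans (+-cong (+-identityˡ (R b)) (γ[1,g]≈0 (0 , b))) (+-identityʳ (R b)))

    φ₀-at : ∀ {f g} → f ≡ g → φ₀ f ≈ φ₀ g
    φ₀-at f≡g = reflexive (cong φ₀ f≡g)

    ∂φ₀[tᵃ,sᵇ] : ∀ a b → ∂ᴹ φ₀ (a , 0) (0 , b) ≈ γ (a , 0) (0 , b)
    ∂φ₀[tᵃ,sᵇ] a b = begin
      1# *ᶠ φ₀ (0 , b) − φ₀ ((a , 0) ∙ (0 , b)) +ᶠ φ₀ (a , 0)
        ≈⟨ +-cong (+-cong (*-congˡ (φ₀[0,b]≈-R b)) (-‿cong (φ₀-at ([a,b]∙[0,y]≡[a,b+y] a 0 b)))) (φ₀[a,0]≈-P a) ⟩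
      1# *ᶠ -ᶠ R b − φ₀ (a , b) +ᶠ -ᶠ P a
        ≈⟨ solve 3 (λ P R G → con (ℤ.+ 1) :* (:- R) :- (:- (P :+ R :+ G)) :+ (:- P) := G) refl (P a) (R b) (γ (a , 0) (0 , b)) ⟩
      γ (a , 0) (0 , b) ∎

    ∂φ₀[tᵃ,t] : ∀ a → ∂ᴹ φ₀ (a , 0) (1 , 0) ≈ γ (a , 0) (1 , 0)
    ∂φ₀[tᵃ,t] a = begin
      1# *ᶠ φ₀ (1 , 0) − φ₀ ((a , 0) ∙ (1 , 0)) +ᶠ φ₀ (a , 0)
        ≈⟨ +-cong (+-cong (*-congˡ (φ₀[a,0]≈-P 1))
                          (-‿cong (trans (φ₀-at (cong (_, 0) (ℕ.+-comm a 1))) (φ₀[a,0]≈-P (suc a)))))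
                  (φ₀[a,0]≈-P a) ⟩
      1# *ᶠ -ᶠ P 1 − -ᶠ (P a +ᶠ γ (a , 0) (1 , 0)) +ᶠ -ᶠ P a
        ≈⟨ solve 3 (λ P₁ P G → con (ℤ.+ 1) :* (:- P₁) :- (:- (P :+ G)) :+ (:- P) := G :- P₁)
                   refl (P 1) (P a) (γ (a , 0) (1 , 0)) ⟩
      γ (a , 0) (1 , 0) − P 1
        ≈⟨ trans (+-congˡ (trans (-‿cong P1≈0) -0#≈0#)) (+-identityʳ _) ⟩
      γ (a , 0) (1 , 0) ∎

    ∂φ₀[sᵇ,s] : ∀ b → ∂ᴹ φ₀ (0 , b) (0 , 1) ≈ γ (0 , b) (0 , 1)
    ∂φ₀[sᵇ,s] b = begin
      powF F u b *ᶠ φ₀ (0 , 1) − φ₀ ((0 , b) ∙ (0 , 1)) +ᶠ φ₀ (0 , b)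
        ≈⟨ +-cong (+-cong (*-congˡ (trans (φ₀[0,b]≈-R 1) (trans (-‿cong R1≈0) -0#≈0#)))
                          (-‿cong (trans (φ₀-at (≡.trans ([a,b]∙[0,y]≡[a,b+y] 0 b 1) (cong (0 ,_) (ℕ.+-comm b 1))))
                                         (φ₀[0,b]≈-R (suc b)))))
                  (φ₀[0,b]≈-R b) ⟩
      powF F u b *ᶠ 0# − -ᶠ (R b +ᶠ γ (0 , b) (0 , 1)) +ᶠ -ᶠ R b
        ≈⟨ solve 3 (λ W R G → W :* con (ℤ.+ 0) :- (:- (R :+ G)) :+ (:- R) := G) refl (powF F u b) (R b) (γ (0 , b) (0 , 1)) ⟩
      γ (0 , b) (0 , 1) ∎

    γ′ : Cochainᴹ₂
    γ′ = γ ⊖ᴹ ∂ᴹ φ₀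

    γ≈∂φ₀ : Φᴹ γ ≈ 0# → ∀ f g → γ f g ≈ ∂ᴹ φ₀ f g
    γ≈∂φ₀ Φᴹγ≈0 f g = x∙y⁻¹≈ε⇒x≈y _ _ (vanish Φᴹγ′≈0 f g)
      where
      open Vanishing γ′ (⊖ᴹ-isCocycle γ-cocycle (∂ᴹ-isCocycle φ₀))
                     (λ a b → x≈y⇒x∙y⁻¹≈ε (sym (∂φ₀[tᵃ,sᵇ] a b)))
                     (λ a → x≈y⇒x∙y⁻¹≈ε (sym (∂φ₀[tᵃ,t] a)))
                     (λ b → x≈y⇒x∙y⁻¹≈ε (sym (∂φ₀[sᵇ,s] b)))
      Φᴹγ′≈0 : Φᴹ γ′ ≈ 0#
      Φᴹγ′≈0 = trans (Φᴹ-homo-⊖ γ (∂ᴹ φ₀))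
                     (trans (+-cong Φᴹγ≈0 (-‿cong (Φᴹ-∂ᴹ φ₀))) (trans (+-congˡ -0#≈0#) (+-identityʳ 0#)))

    module _ {n m : ℕ} (γ-periodic : ∀ {f f′ g g′} → Closeᴹ n m f f′ → Closeᴹ n m g g′ → γ f g ≈ γ f′ g′) where

      φ₀-mod : ∀ {n′ m′} → ℓ * suc n ∣ suc n′ → ℓ * suc m ∣ suc m′ →
               ∀ a b → φ₀ (a , b) ≈ φ₀ (a % suc n′ , b % suc m′)
      φ₀-mod {n′} {m′} ℓN∣N′ ℓM∣M′ a b = -‿cong (+-cong (+-cong P-mod R-mod) γ-mod)
        where
        P-mod : P a ≈ P (a % suc n′)
        P-mod = Σ<-mod (λ i → γ-periodic ([m+n]%n≡m%n i (suc n) , ≡.refl) (≡.refl , ≡.refl)) ℓN∣N′ a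
        R-mod : R b ≈ R (b % suc m′)
        R-mod = Σ<-mod (λ j → γ-periodic (≡.refl , [m+n]%n≡m%n j (suc m)) (≡.refl , ≡.refl)) ℓM∣M′ b
        γ-mod : γ (a , 0) (0 , b) ≈ γ (a % suc n′ , 0) (0 , b % suc m′)
        γ-mod = γ-periodic (≡.sym (m∣n⇒o%n%m≡o%m (suc n) (suc n′) a (∣-trans (n∣m*n ℓ) ℓN∣N′)) , ≡.refl)
                           (≡.refl , ≡.sym (m∣n⇒o%n%m≡o%m (suc m) (suc m′) b (∣-trans (n∣m*n ℓ) ℓM∣M′)))

module Ḡ-Cohomology (p k l : ℕ) {c r : Level} (F : CommutativeRing c r)
  (p-prime : Prime p) (ℓ-prime : Prime (suc (suc l))) (ℓ≢p : ¬ (suc (suc l) ≡ p))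
  (ℓ≈0 : CommutativeRing._≈_ F (natF F (suc (suc l))) (CommutativeRing.0# F)) where

  open Coh p k (suc (suc l)) F
  open CommutativeRing F
    using (refl; sym; trans; reflexive; setoid; +-cong; +-congˡ; +-congʳ; *-cong; *-congˡ; *-congʳ; -‿cong;
           zeroˡ; zeroʳ; +-identityˡ; +-identityʳ; *-identityˡ; *-identityʳ)
  open CommutativeRingSolver F using (solve; _:=_; _:+_; _:*_; _:-_; :-_; con)
  open Numerals F
  open Characteristic F l ℓ-prime ℓ≈0 using (ℓ; natF-mod; natF[ℓ∸1]≈-1)
  open ℕ⋊ℕ-Cohomology p k l F p-prime ℓ-prime ℓ≢p ℓ≈0
  open SetoidReasoning setoid

  -- A function rather than a record, with Ḡ-valued arguments passed explicitly below: comparing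
  -- two elements of Ḡ that are not syntactically equal unfolds the compat proofs inside Lim and
  -- is prohibitively slow, whereas comparing two ≃-types only compares ℕ components.
  infix 4 _≃_
  _≃_ : Gbar → Gbar → Set
  g ≃ g′ = ∀ n (hn : PrimeTo p n) m → Close n hn m g g′

  ≃-refl : ∀ g → g ≃ g
  ≃-refl g n hn m = ≡.refl , ≡.refl

  ≃-trans : ∀ g g′ g″ → g ≃ g′ → g′ ≃ g″ → g ≃ g″
  ≃-trans g g′ g″ g≃g′ g′≃g″ n hn m =
    ≡.trans (proj₁ (g≃g′ n hn m)) (proj₁ (g′≃g″ n hn m)) , ≡.trans (proj₂ (g≃g′ n hn m)) (proj₂ (g′≃g″ n hn m))

  ·-za-cong : ∀ {g g′ h h′ n} (hn : PrimeTo p n) →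
              comp (za g) n hn ≡ comp (za g′) n hn → comp (zb g) (fac n) tt ≡ comp (zb g′) (fac n) tt →
              comp (za h) n hn ≡ comp (za h′) n hn → comp (za (g · h)) n hn ≡ comp (za (g′ · h′)) n hn
  ·-za-cong {n = n} hn gₐ bg hₐ =
    cong₂ (λ a x → (a + x % suc n) % suc n) gₐ (cong₂ (λ b a → q ^ b * a) bg hₐ)

  ·-zb-cong : ∀ {g g′ h h′} m → comp (zb g) m tt ≡ comp (zb g′) m tt → comp (zb h) m tt ≡ comp (zb h′) m tt →
              comp (zb (g · h)) m tt ≡ comp (zb (g′ · h′)) m tt
  ·-zb-cong m g_b h_b = cong₂ (λ b y → (b + y) % suc m) g_b h_b

  ·-cong : ∀ g g′ h h′ → g ≃ g′ → h ≃ h′ → g · h ≃ g′ · h′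
  ·-cong g g′ h h′ g≃g′ h≃h′ n hn m =
    ·-za-cong {g} {g′} {h} {h′} hn (proj₁ (g≃g′ n hn m)) (proj₂ (g≃g′ n hn (fac n))) (proj₁ (h≃h′ n hn m)) ,
    ·-zb-cong {g} {g′} {h} {h′} m (proj₂ (g≃g′ n hn m)) (proj₂ (h≃h′ n hn m))

  Close-sym : ∀ {n} {hn : PrimeTo p n} {m g g′} → Close n hn m g g′ → Close n hn m g′ g
  Close-sym (a≡ , b≡) = ≡.sym a≡ , ≡.sym b≡

  Close-coarsen : ∀ {n n′ m m′ g g′} (hn : PrimeTo p n) (hn′ : PrimeTo p n′) →
                  suc n ∣ suc n′ → suc m ∣ suc m′ → Close n′ hn′ m′ g g′ → Close n hn m g g′
  Close-coarsen {g = g} {g′} hn hn′ n∣n′ m∣m′ (a≡ , b≡) =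
    comp-coarsen (za g) (za g′) hn hn′ n∣n′ a≡ , comp-coarsen (zb g) (zb g′) tt tt m∣m′ b≡

  ·-close : ∀ {n m g g′ h h′} (hn : PrimeTo p n) → suc (fac n) ∣ suc m →
            Close n hn m g g′ → Close n hn m h h′ → Close n hn m (g · h) (g′ · h′)
  ·-close {n} {m} {g} {g′} {h} {h′} hn fac∣m (gₐ , g_b) (hₐ , h_b) =
    ·-za-cong {g} {g′} {h} {h′} hn gₐ (comp-coarsen (zb g) (zb g′) tt tt fac∣m g_b) hₐ ,
    ·-zb-cong {g} {g′} {h} {h′} m g_b h_b

  W : ℕ × ℕ → Gbar
  W (a , b) = ι a , ι b

  q^-mod : ∀ n → PrimeTo p n → ∀ b → (q ^ b) % suc n ≡ (q ^ (b % suc (fac n))) % suc n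
  q^-mod n hn = pow-red q n (suc (fac n)) (≡.subst (λ K → (q ^ K) % suc n ≡ 1 % suc n) (≡.sym (sfac n))
                                                   (euler! q n (Coprime.sym (coprime-^ k hn))))

  W-homo : ∀ f g → W f · W g ≃ W (f ∙ g)
  W-homo (a , b) (x , y) n hn m = za-part n hn , ≡.sym (%-distribˡ-+ b y (suc m))
    where
    za-part : ∀ n → PrimeTo p n →
              (a % suc n + (q ^ (b % suc (fac n)) * (x % suc n)) % suc n) % suc n ≡ (a + q ^ b * x) % suc n
    za-part n hn = ≡.trans (≡.sym (%-distribˡ-+ a (q ^ (b % suc (fac n)) * (x % suc n)) (suc n)))
                (+-mod a a _ _ n ≡.refl (*-mod (q ^ (b % suc (fac n))) (q ^ b) (x % suc n) x n
                                               (≡.sym (q^-mod n hn b)) (m%n%n≡m%n x (suc n))))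

  W-cong : ∀ {f f′} → f ≡ f′ → W f ≃ W f′
  W-cong {f} ≡.refl = ≃-refl (W f)

  t^ᴳ≃W : ∀ i → t ^ᴳ i ≃ W (i , 0)
  t^ᴳ≃W zero    = ≃-refl e
  t^ᴳ≃W (suc i) = ≃-trans (t · t ^ᴳ i) (W (1 , 0) · W (i , 0)) (W (suc i , 0))
    (·-cong t (W (1 , 0)) (t ^ᴳ i) (W (i , 0)) (≃-refl t) (t^ᴳ≃W i))
    (≃-trans (W (1 , 0) · W (i , 0)) (W ((1 , 0) ∙ (i , 0))) (W (suc i , 0))
             (W-homo (1 , 0) (i , 0)) (W-cong ([a,0]∙[x,y]≡[a+x,y] 1 i 0)))

  s^ᴳ≃W : ∀ j → s ^ᴳ j ≃ W (0 , j)
  s^ᴳ≃W zero    = ≃-refl e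
  s^ᴳ≃W (suc j) = ≃-trans (s · s ^ᴳ j) (W (0 , 1) · W (0 , j)) (W (0 , suc j))
    (·-cong s (W (0 , 1)) (s ^ᴳ j) (W (0 , j)) (≃-refl s) (s^ᴳ≃W j))
    (≃-trans (W (0 , 1) · W (0 , j)) (W ((0 , 1) ∙ (0 , j))) (W (0 , suc j))
             (W-homo (0 , 1) (0 , j)) (W-cong ([a,b]∙[0,y]≡[a,b+y] 0 1 j)))

  coords : (n : ℕ) → PrimeTo p n → ℕ → Gbar → ℕ × ℕ
  coords n hn m g = comp (za g) n hn , comp (zb g) m tt

  Close-W-coords : ∀ {n} (hn : PrimeTo p n) m g → Close n hn m g (W (coords n hn m g))
  Close-W-coords {n} hn m g = ≡.sym (compat (za g) n n hn hn ∣-refl) , ≡.sym (compat (zb g) m m tt tt ∣-refl)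

  ℓ⊥p : Coprime ℓ p
  ℓ⊥p = coprime-primes ℓ-prime p-prime ℓ≢p

  ▹-W : ∀ f x → W f ▹ x ≈ f ▸ x
  ▹-W (a , b) x = *-congʳ (sym (powF-mod u^[ℓ∸1]≈1 b))

  ▹-homo : ∀ g h x → (g · h) ▹ x ≈ g ▹ h ▹ x
  ▹-homo g h x = begin
    powF F u ((b + b′) % suc l) *ᶠ x          ≈⟨ *-congʳ (powF-mod u^[ℓ∸1]≈1 (b + b′)) ⟨
    powF F u (b + b′) *ᶠ x                    ≈⟨ *-congʳ (powF-homo-+ u b b′) ⟩
    powF F u b *ᶠ powF F u b′ *ᶠ x            ≈⟨ CommutativeRing.*-assoc F _ _ _ ⟩
    powF F u b *ᶠ (powF F u b′ *ᶠ x)          ∎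
    where
    b  = comp (zb g) l tt
    b′ = comp (zb h) l tt

  ▹-close : ∀ {g g′} m x → suc l ∣ suc m → comp (zb g) m tt ≡ comp (zb g′) m tt → g ▹ x ≈ g′ ▹ x
  ▹-close {g} {g′} m x l∣m b≡ = *-congʳ (reflexive (cong (powF F u) (comp-coarsen (zb g) (zb g′) tt tt l∣m b≡)))

  ∂ : Cochain₁ → Cochain₂
  ∂ φ g h = g ▹ φ h − φ (g · h) +ᶠ φ g

  restrict₁ : Cochain₁ → Cochainᴹ₁
  restrict₁ φ f = φ (W f)

  restrict₂ : Cochain₂ → Cochainᴹ₂
  restrict₂ γ f g = γ (W f) (W g)

  continuous₁⇒≃-resp : ∀ {φ} → Continuous₁ φ → ∀ {g g′} → g ≃ g′ → φ g ≈ φ g′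
  continuous₁⇒≃-resp (n , hn , m , φ-local) {g} {g′} g≃g′ = φ-local g g′ (g≃g′ n hn m)

  continuous₂⇒≃-resp : ∀ {γ} → Continuous₂ γ → ∀ {g g′ h h′} → g ≃ g′ → h ≃ h′ → γ g h ≈ γ g′ h′
  continuous₂⇒≃-resp (n , hn , m , γ-local) {g} {g′} {h} {h′} g≃g′ h≃h′ =
    γ-local g g′ h h′ (g≃g′ n hn m) (h≃h′ n hn m)

  ∂-restrict : ∀ {φ} → (∀ {g g′} → g ≃ g′ → φ g ≈ φ g′) →
               ∀ f f′ → ∂ φ (W f) (W f′) ≈ ∂ᴹ (restrict₁ φ) f f′
  ∂-restrict φ-resp f f′ = +-congʳ (+-cong (▹-W f _) (-‿cong (φ-resp (W-homo f f′))))

  restrict-isCocycle : ∀ {γ} → IsNormalizedCocycle γ → IsCocycleᴹ (restrict₂ γ)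
  restrict-isCocycle {γ} γ-cocycle f g h = trans
    (+-congʳ (+-cong (+-cong (sym (▹-W f (γ (W g) (W h))))
                             (-‿cong (sym (γ-resp {W f · W g} {W (f ∙ g)} {W h} {W h} (W-homo f g) (≃-refl (W h))))))
                     (sym (γ-resp {W f} {W f} {W g · W h} {W (g ∙ h)} (≃-refl (W f)) (W-homo g h)))))
    (IsNormalizedCocycle.cocycle γ-cocycle (W f) (W g) (W h))
    where γ-resp = continuous₂⇒≃-resp (IsNormalizedCocycle.continuous γ-cocycle)

  Φ≈Φᴹ : ∀ {γ} → Continuous₂ γ → Φ γ ≈ Φᴹ (restrict₂ γ)
  Φ≈Φᴹ γ-continuous =
    +-cong (+-cong (Σ₁-cong (q ^ suc l ∸ 1) (λ i → γ-resp (t^ᴳ≃W i) (≃-refl t)))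
                   (γ-resp (t^ᴳ≃W (q ^ suc l)) (s^ᴳ≃W (suc l))))
           (-‿cong (γ-resp (s^ᴳ≃W (suc l)) (≃-refl t)))
    where γ-resp = continuous₂⇒≃-resp γ-continuous

  Φ-homo-⊕ : ∀ γ δ → Φ (γ ⊕ δ) ≈ Φ γ +ᶠ Φ δ
  Φ-homo-⊕ γ δ = trans (+-congʳ (+-congʳ (Σ₁-homo-+ (q ^ suc l ∸ 1) (λ i → γ (t ^ᴳ i) t) (λ i → δ (t ^ᴳ i) t))))
    (solve 6 (λ a b x y z w → a :+ b :+ (x :+ y) :- (z :+ w) := (a :+ x :- z) :+ (b :+ y :- w)) refl _ _ _ _ _ _)

  Φ-homo-⊙ : ∀ x γ → Φ (x ⊙ γ) ≈ x *ᶠ Φ γ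
  Φ-homo-⊙ x γ = trans (+-congʳ (+-congʳ (Σ₁-homo-* (q ^ suc l ∸ 1) x (λ i → γ (t ^ᴳ i) t))))
    (solve 4 (λ x a b c → x :* a :+ x :* b :- x :* c := x :* (a :+ b :- c)) refl x _ _ _)

  Φ-coboundary≈0 : ∀ γ → IsNormalizedCocycle γ → IsCoboundary γ → Φ γ ≈ 0#
  Φ-coboundary≈0 γ γ-cocycle (φ , φ-continuous , γ≈∂φ) = begin
    Φ γ                            ≈⟨ Φ≈Φᴹ (IsNormalizedCocycle.continuous γ-cocycle) ⟩
    Φᴹ (restrict₂ γ)               ≈⟨ Φᴹ-cong (λ f f′ → trans (γ≈∂φ (W f) (W f′))
                                                               (∂-restrict (λ {g} {g′} → φ-resp {g} {g′}) f f′)) ⟩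
    Φᴹ (∂ᴹ (restrict₁ φ))          ≈⟨ Φᴹ-∂ᴹ (restrict₁ φ) ⟩
    0#                             ∎
    where φ-resp = continuous₁⇒≃-resp φ-continuous

  module Cobounding (γ : Cochain₂) (γ-cocycle : IsNormalizedCocycle γ) (Φγ≈0 : Φ γ ≈ 0#)
                    (n₀ : ℕ) (hn₀ : PrimeTo p n₀) (m₀ : ℕ)
                    (γ-local : ∀ g g′ h h′ → Close n₀ hn₀ m₀ g g′ → Close n₀ hn₀ m₀ h h′ → γ g h ≈ γ g′ h′) where
    open IsNormalizedCocycle γ-cocycle
    open Trivialisation (restrict₂ γ) (restrict-isCocycle γ-cocycle) (λ g → normˡ (W g)) (λ f → normʳ (W f))

    -- (n′ , m′) refines (n₀ , m₀) by the factor ℓ that φ₀-mod needs; m′ is moreover divisible by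
    -- ℓ - 1 for ▹ and by suc (fac n′) for ·-close.
    n′ : ℕ
    n′ = n₀ + suc l * suc n₀

    hn′ : PrimeTo p n′
    hn′ = Coprime.sym (coprime-* (Coprime.sym ℓ⊥p) (Coprime.sym hn₀))

    m′ : ℕ
    m′ = ℕ.pred (ℓ * suc m₀ * suc l * suc (fac n′))

    ℓM∣M′ : ℓ * suc m₀ ∣ suc m′
    ℓM∣M′ = ∣-trans (m∣m*n (suc l)) (m∣m*n (suc (fac n′)))

    φ : Cochain₁
    φ g = φ₀ (coords n′ hn′ m′ g)

    φ-close : ∀ {g g′} → Close n′ hn′ m′ g g′ → φ g ≈ φ g′
    φ-close (a≡ , b≡) = reflexive (cong₂ (λ a b → φ₀ (a , b)) a≡ b≡)

    φ∘W≈φ₀ : ∀ f → φ (W f) ≈ φ₀ f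
    φ∘W≈φ₀ (a , b) = sym (φ₀-mod (λ {f} {f′} {g} {g′} → γ-local (W f) (W f′) (W g) (W g′)) ∣-refl ℓM∣M′ a b)

    γ-close : ∀ {g g′ h h′} → Close n′ hn′ m′ g g′ → Close n′ hn′ m′ h h′ → γ g h ≈ γ g′ h′
    γ-close {g} {g′} {h} {h′} g~g′ h~h′ = γ-local g g′ h h′ (coarsen {g} {g′} g~g′) (coarsen {h} {h′} h~h′)
      where
      coarsen : ∀ {x y} → Close n′ hn′ m′ x y → Close n₀ hn₀ m₀ x y
      coarsen {x} {y} = Close-coarsen {g = x} {y} hn₀ hn′ (n∣m*n ℓ) (∣-trans (n∣m*n ℓ) ℓM∣M′)

    ∂φ-close : ∀ {g g′ h h′} → Close n′ hn′ m′ g g′ → Close n′ hn′ m′ h h′ → ∂ φ g h ≈ ∂ φ g′ h′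
    ∂φ-close {g} {g′} {h} {h′} g~g′ h~h′ =
      +-cong (+-cong (trans (▹-close {g} {g′} m′ (φ h) l∣M′ (proj₂ g~g′)) (*-congˡ (φ-close {h} {h′} h~h′)))
                     (-‿cong (φ-close {g · h} {g′ · h′} (·-close {g = g} {g′} {h} {h′} hn′ fac∣M′ g~g′ h~h′))))
             (φ-close {g} {g′} g~g′)
      where
      l∣M′ : suc l ∣ suc m′
      l∣M′ = ∣-trans (n∣m*n (ℓ * suc m₀)) (m∣m*n (suc (fac n′)))
      fac∣M′ : suc (fac n′) ∣ suc m′
      fac∣M′ = n∣m*n (ℓ * suc m₀ * suc l)

    γ≈∂φ-on-W : ∀ f f′ → γ (W f) (W f′) ≈ ∂ φ (W f) (W f′)
    γ≈∂φ-on-W f f′ = begin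
      γ (W f) (W f′)               ≈⟨ γ≈∂φ₀ (trans (sym (Φ≈Φᴹ continuous)) Φγ≈0) f f′ ⟩
      ∂ᴹ φ₀ f f′                   ≈⟨ ∂ᴹ-cong (λ f → sym (φ∘W≈φ₀ f)) f f′ ⟩
      ∂ᴹ (restrict₁ φ) f f′        ≈⟨ ∂-restrict (λ {g} {g′} g≃g′ → φ-close {g} {g′} (g≃g′ n′ hn′ m′)) f f′ ⟨
      ∂ φ (W f) (W f′)             ∎

    γ≈∂φ : ∀ g h → γ g h ≈ ∂ φ g h
    γ≈∂φ g h = begin
      γ g h                        ≈⟨ γ-close {g} {W ĝ} {h} {W ĥ} (Close-W-coords hn′ m′ g) (Close-W-coords hn′ m′ h) ⟩
      γ (W ĝ) (W ĥ)                ≈⟨ γ≈∂φ-on-W ĝ ĥ ⟩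
      ∂ φ (W ĝ) (W ĥ)              ≈⟨ ∂φ-close {W ĝ} {g} {W ĥ} {h}
                                        (Close-sym {hn = hn′} {g = g} {W ĝ} (Close-W-coords hn′ m′ g))
                                        (Close-sym {hn = hn′} {g = h} {W ĥ} (Close-W-coords hn′ m′ h)) ⟩
      ∂ φ g h                      ∎
      where
      ĝ = coords n′ hn′ m′ g
      ĥ = coords n′ hn′ m′ h

    isCoboundary : IsCoboundary γ
    isCoboundary = φ , (n′ , hn′ , m′ , λ g g′ → φ-close {g} {g′}) , γ≈∂φ

  Φ≈0⇒coboundary : ∀ γ → IsNormalizedCocycle γ → Φ γ ≈ 0# → IsCoboundary γ
  Φ≈0⇒coboundary γ γ-cocycle Φγ≈0 =
    Cobounding.isCoboundary γ γ-cocycle Φγ≈0 (proj₁ γ-continuous) (proj₁ (proj₂ γ-continuous))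
                            (proj₁ (proj₂ (proj₂ γ-continuous))) (proj₂ (proj₂ (proj₂ γ-continuous)))
    where γ-continuous = IsNormalizedCocycle.continuous γ-cocycle

  _∪_ : Cochain₁ → Cochain₁ → Cochain₂
  (χ ∪ κ) g h = χ g *ᶠ g ▹ κ h

  ∪-cocycle : ∀ χ κ → (∀ g h → χ (g · h) ≈ χ g +ᶠ χ h) → (∀ g h → κ (g · h) ≈ κ g +ᶠ g ▹ κ h) →
              ∀ f g h → f ▹ (χ ∪ κ) g h − (χ ∪ κ) (f · g) h +ᶠ (χ ∪ κ) f (g · h) − (χ ∪ κ) f g ≈ 0#
  ∪-cocycle χ κ χ-homo κ-crossed f g h = begin
    f ▹ (χ g *ᶠ g ▹ κ h) − χ (f · g) *ᶠ (f · g) ▹ κ h +ᶠ χ f *ᶠ f ▹ κ (g · h) − χ f *ᶠ f ▹ κ g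
      ≈⟨ +-congʳ (+-cong (+-congˡ (-‿cong (*-cong (χ-homo f g) (▹-homo f g (κ h)))))
                         (*-congˡ (*-congˡ (κ-crossed g h)))) ⟩
    f ▹ (χ g *ᶠ g ▹ κ h) − (χ f +ᶠ χ g) *ᶠ f ▹ g ▹ κ h +ᶠ χ f *ᶠ f ▹ (κ g +ᶠ g ▹ κ h) − χ f *ᶠ f ▹ κ g
      ≈⟨ solve 6 (λ U V a b x y → U :* (b :* (V :* y)) :- (a :+ b) :* (U :* (V :* y))
                                    :+ a :* (U :* (x :+ V :* y)) :- a :* (U :* x) := con (ℤ.+ 0))
               refl (powF F u (comp (zb f) l tt)) (powF F u (comp (zb g) l tt)) (χ f) (χ g) (κ g) (κ h) ⟩
    0# ∎

  module Surjectivity (x : Carrier) where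

    χ : Cochain₁
    χ g = x *ᶠ natF F (comp (zb g) (suc l) tt)

    κ : Cochain₁
    κ g = natF F (comp (za g) (suc l) ℓ⊥p)

    χ-homo : ∀ g h → χ (g · h) ≈ χ g +ᶠ χ h
    χ-homo g h = begin
      x *ᶠ natF F ((b + b′) % ℓ)              ≈⟨ *-congˡ (natF-mod (b + b′)) ⟨
      x *ᶠ natF F (b + b′)                    ≈⟨ *-congˡ (natF-homo-+ b b′) ⟩
      x *ᶠ (natF F b +ᶠ natF F b′)            ≈⟨ CommutativeRing.distribˡ F x _ _ ⟩
      x *ᶠ natF F b +ᶠ x *ᶠ natF F b′         ∎
      where
      b  = comp (zb g) (suc l) tt
      b′ = comp (zb h) (suc l) tt

    κ-crossed : ∀ g h → κ (g · h) ≈ κ g +ᶠ g ▹ κ h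
    κ-crossed g h = begin
      natF F ((a + (q ^ B * a′) % ℓ) % ℓ)                ≈⟨ natF-mod (a + (q ^ B * a′) % ℓ) ⟨
      natF F (a + (q ^ B * a′) % ℓ)                      ≈⟨ natF-homo-+ a _ ⟩
      natF F a +ᶠ natF F ((q ^ B * a′) % ℓ)              ≈⟨ +-congˡ (natF-mod (q ^ B * a′)) ⟨
      natF F a +ᶠ natF F (q ^ B * a′)                    ≈⟨ +-congˡ (natF-homo-* (q ^ B) a′) ⟩
      natF F a +ᶠ natF F (q ^ B) *ᶠ natF F a′            ≈⟨ +-congˡ (*-congʳ (natF-homo-^ q B)) ⟩
      natF F a +ᶠ powF F u B *ᶠ natF F a′                ≈⟨ +-congˡ (*-congʳ (powF-mod u^[ℓ∸1]≈1 B)) ⟩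
      natF F a +ᶠ powF F u (B % suc l) *ᶠ natF F a′      ≡⟨ cong (λ b → natF F a +ᶠ powF F u b *ᶠ natF F a′)
                                                               (compat (zb g) l (fac (suc l)) tt tt l∣fac) ⟩
      natF F a +ᶠ g ▹ natF F a′                          ∎
      where
      a  = comp (za g) (suc l) ℓ⊥p
      a′ = comp (za h) (suc l) ℓ⊥p
      B  = comp (zb g) (fac (suc l)) tt
      l∣fac : suc l ∣ suc (fac (suc l))
      l∣fac = ≡.subst (suc l ∣_) (≡.sym (sfac (suc l))) (∣-trans (n∣n! l) (n∣m*n ℓ))

    γₓ : Cochain₂
    γₓ = χ ∪ κ

    m* : ℕ
    m* = l + suc l * suc l

    γₓ-continuous : Continuous₂ γₓ
    γₓ-continuous = suc l , ℓ⊥p , m* , λ g g′ h h′ g~g′ h~h′ →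
      *-cong (*-congˡ (reflexive (cong (natF F) (comp-coarsen (zb g) (zb g′) tt tt (m∣m*n (suc l)) (proj₂ g~g′)))))
             (trans (▹-close {g} {g′} m* (κ h) (n∣m*n ℓ) (proj₂ g~g′)) (*-congˡ (reflexive (cong (natF F) (proj₁ h~h′)))))

    γₓ-isNormalizedCocycle : IsNormalizedCocycle γₓ
    γₓ-isNormalizedCocycle = record
      { continuous = γₓ-continuous
      ; normˡ      = λ g → trans (*-congʳ (zeroʳ x)) (zeroˡ _)
      ; normʳ      = λ g → trans (*-congˡ (zeroʳ _)) (zeroʳ _)
      ; cocycle    = ∪-cocycle χ κ χ-homo κ-crossed
      }

    γₓ[tᵃ,-]≈0 : ∀ a g → γₓ (W (a , 0)) g ≈ 0#
    γₓ[tᵃ,-]≈0 a g = trans (*-congʳ (zeroʳ x)) (zeroˡ _)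

    Φγₓ≈x : Φ γₓ ≈ x
    Φγₓ≈x = begin
      Φ γₓ                   ≈⟨ Φ≈Φᴹ γₓ-continuous ⟩
      Φᴹ (restrict₂ γₓ)      ≈⟨ +-cong (+-cong (Σ₁-zero (q ^ suc l ∸ 1) (λ i → γₓ[tᵃ,-]≈0 i (W (1 , 0))))
                                               (γₓ[tᵃ,-]≈0 (q ^ suc l) (W (0 , suc l))))
                                       (-‿cong γₓ[sˡ⁺¹,t]≈-x) ⟩
      0# +ᶠ 0# − -ᶠ x        ≈⟨ solve 1 (λ x → con (ℤ.+ 0) :+ con (ℤ.+ 0) :- (:- x) := x) refl x ⟩
      x                      ∎
      where
      γₓ[sˡ⁺¹,t]≈-x : γₓ (W (0 , suc l)) (W (1 , 0)) ≈ -ᶠ x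
      γₓ[sˡ⁺¹,t]≈-x = begin
        x *ᶠ natF F (suc l % ℓ) *ᶠ (powF F u (suc l % suc l) *ᶠ natF F 1)
          ≈⟨ *-cong (*-congˡ (trans (reflexive (cong (natF F) (m<n⇒m%n≡m (ℕ.n<1+n (suc l))))) natF[ℓ∸1]≈-1))
                    (*-congʳ (reflexive (cong (powF F u) (n%n≡0 (suc l))))) ⟩
        x *ᶠ -ᶠ 1# *ᶠ (1# *ᶠ (1# +ᶠ 0#))
          ≈⟨ solve 1 (λ x → x :* (:- con (ℤ.+ 1)) :* (con (ℤ.+ 1) :* (con (ℤ.+ 1) :+ con (ℤ.+ 0))) := :- x) refl x ⟩
        -ᶠ x
          ∎

  surjective : ∀ x → Σ[ γ ∈ Cochain₂ ] (IsNormalizedCocycle γ × Φ γ ≈ x)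
  surjective x = γₓ , γₓ-isNormalizedCocycle , Φγₓ≈x
    where open Surjectivity x

mainTheorem4 : ∀ {c r} (p k ℓ : ℕ) → Prime p → 1 ≤ k → Prime ℓ → ¬ (ℓ ≡ p) →
    (F : CommutativeRing c r) → IsField F → IsFinite F → HasCharacteristic F ℓ →
    let open Coh p k ℓ F in ((∀ γ δ → IsNormalizedCocycle γ → IsNormalizedCocycle δ → Φ (γ ⊕ δ) ≈ Φ γ +ᶠ Φ δ)
    × (∀ x γ → IsNormalizedCocycle γ → Φ (x ⊙ γ) ≈ x *ᶠ Φ γ)
    × (∀ γ → IsNormalizedCocycle γ → IsCoboundary γ → Φ γ ≈ 0#)
    × (∀ γ → IsNormalizedCocycle γ → Φ γ ≈ 0# → IsCoboundary γ)
    × (∀ x → Σ[ γ ∈ Cochain₂ ] (IsNormalizedCocycle γ × Φ γ ≈ x)))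
mainTheorem4 p k zero          _ _ ℓ-prime = ⊥-elim (contradiction (prime⇒2≤ ℓ-prime) λ ())
mainTheorem4 p k (suc zero)    _ _ ℓ-prime = ⊥-elim (contradiction (prime⇒2≤ ℓ-prime) λ { (s≤s ()) })
mainTheorem4 p k (suc (suc l)) p-prime _ ℓ-prime ℓ≢p F _ _ (_ , ℓ≈0 , _) =
  (λ γ δ _ _ → Φ-homo-⊕ γ δ) , (λ x γ _ → Φ-homo-⊙ x γ) , Φ-coboundary≈0 , Φ≈0⇒coboundary , surjective
  where open Ḡ-Cohomology p k l F p-prime ℓ-prime ℓ≢p ℓ≈0
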